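{- Let $n \geq 5$ and let $\mathcal{P}=(P,w)$ be an essential, internal-nonzero-weighted tree with leaf set $L(P)=[n]$. Let $i,j,l,m\in[n]$ be distinct. Then $\langle i,j\mid l,m\rangle$ holds in $P$ if and only if at least one of the following holds: (a) there exists $r \in [n]-\{i,j,l,m\}$ such that $$D_{\{i,j,l\}}(\mathcal{P}) + D_{\{m,r,l\}}(\mathcal{P}) \neq D_{\{i,r,l\}}(\mathcal{P}) + D_{\{m,j,l\}}(\mathcal{P})$$ and also the three inequalities obtained from this one by swapping $i$ with $j$, by swapping $l$ with $m$, and by doing both swaps, hold; (b) for every $r \in [n]-\{i,j,l,m\}$, $$D_{\{i,j,r\}}(\mathcal{P}) + D_{\{m,l,r\}}(\mathcal{P}) \neq D_{\{i,m,r\}}(\mathcal{P}) + D_{\{j,l,r\}}(\mathcal{P})\quad\text{and}\quad D_{\{i,j,r\}}(\mathcal{P}) + D_{\{m,l,r\}}(\mathcal{P}) \neq D_{\{i,l,r\}}(\mathcal{P}) + D_{\{j,m,r\}}(\mathcal{P}).$$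
   Context: All trees are finite. A weighted tree $\mathcal{T}=(T,w)$ is a tree with $w:E(T)\to\mathbb{R}$. $L(T)$ is the set of leaves. For a set $I$ of vertices, $D_I(\mathcal{T})$ is the sum of the weights of the edges of the minimal subtree of $T$ containing $I$; $T|_S$ denotes the minimal subtree containing $S$. A node is a vertex of degree $>2$; a tree is essential if it has no vertex of degree $2$. The twig of a leaf $F$ is the path from $F$ to the node $N$ such that the path contains no node other than $N$; an edge is internal if it lies on no twig. Internal-nonzero-weighted means all internal edges have nonzero weight. Two leaves are neighbours if the path between them contains exactly one node. For leaves $i,j,l,m$, $\langle i,j\mid l,m\rangle$ holds if in $T|_{\{i,j,l,m\}}$ the leaves $i,j$ are neighbours, $l,m$ are neighbours, and $i,l$ are not neighbours. -}

module Defs where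

open import Level using (0ℓ)
open import Data.Nat as ℕ using (ℕ; zero; suc)
open import Data.Fin using (Fin; zero; suc)
open import Data.Fin.Properties using (_≟_)
open import Data.Bool using (Bool; true; false; _∧_; _∨_; not; _xor_; if_then_else_; T)
open import Data.List using (List; []; _∷_; upTo)
open import Data.Bool.ListAction using (any)
open import Data.Product using (Σ; ∃; ∃-syntax; _×_; _,_)
open import Data.Sum using (_⊎_)
open import Relation.Binary.PropositionalEquality using (_≡_; _≢_)
open import Relation.Nullary using (¬_)
open import Relation.Nullary.Decidable using (⌊_⌋)
open import Algebra.Structures using (IsCommutativeRing)
open import Function.Definitions using (Injective)
open import Function.Bundles using (_⇔_)

-- The real numbers, axiomatised as a Dedekind-complete ordered field
-- (every model is isomorphic to ℝ).

record RealField : Set₁ where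
  infixl 6 _+_
  infixl 7 _*_
  infix 4 _<_
  field
    ℝ : Set
    _+_ _*_ : ℝ → ℝ → ℝ
    -_ : ℝ → ℝ
    0ℝ 1ℝ : ℝ
    _<_ : ℝ → ℝ → Set
    isCommutativeRing : IsCommutativeRing _≡_ _+_ _*_ -_ 0ℝ 1ℝ
    0≢1 : 0ℝ ≢ 1ℝ
    inverse : ∀ x → x ≢ 0ℝ → ∃[ y ] (x * y ≡ 1ℝ)
    <-irrefl : ∀ x → ¬ (x < x)
    <-trans : ∀ {x y z} → x < y → y < z → x < z
    <-trichotomy : ∀ x y → x < y ⊎ (x ≡ y ⊎ y < x)
    +-mono-< : ∀ {x y} z → x < y → x + z < y + z
    *-pos : ∀ {x y} → 0ℝ < x → 0ℝ < y → 0ℝ < x * y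
    complete : (P : ℝ → Set) → ∃[ x ] P x →
               ∃[ b ] (∀ x → P x → x < b ⊎ x ≡ b) →
               ∃[ s ] ((∀ x → P x → x < s ⊎ x ≡ s) ×
                       (∀ b → (∀ x → P x → x < b ⊎ x ≡ b) → s < b ⊎ s ≡ b))

-- The edges are {v , parent v} for v ≢ root (the edge is
-- named by its lower endpoint v).  'depth' witnesses acyclicity /
-- connectedness (following parents strictly decreases depth, so it
-- terminates at the root).

record Tree (N : ℕ) : Set where
  field
    root   : Fin N
    parent : Fin N → Fin N
    depth  : Fin N → ℕ
    parent-root : parent root ≡ root
    depth-dec   : ∀ v → v ≢ root → depth (parent v) ℕ.< depth v

countFin : ∀ {N} → (Fin N → Bool) → ℕ
countFin {zero} f = 0
countFin {suc N} f = (if f zero then 1 else 0) ℕ.+ countFin (λ i → f (suc i))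

module _ {N : ℕ} (t : Tree N) where
  open Tree t

  iter : ℕ → Fin N → Fin N
  iter zero u = u
  iter (suc k) u = parent (iter k u)

  -- below u v : v is an ancestor of u or v = u (u lies in the subtree
  -- hanging below v).  Paths to the root have < N edges, so N steps suffice.
  below : Fin N → Fin N → Bool
  below u v = any (λ k → ⌊ iter k u ≟ v ⌋) (upTo N)

  isEdge : Fin N → Bool
  isEdge e = not ⌊ e ≟ root ⌋

  incident : Fin N → Fin N → Bool
  incident x e = isEdge e ∧ (⌊ e ≟ x ⌋ ∨ ⌊ parent e ≟ x ⌋)

  onPathE : Fin N → Fin N → Fin N → Bool
  onPathE a b e = isEdge e ∧ (below a e xor below b e)

  OnPathV : Fin N → Fin N → Fin N → Set
  OnPathV a b x = x ≡ a ⊎ (x ≡ b ⊎ ∃[ e ] T (onPathE a b e ∧ incident x e))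

  -- edge e belongs to the minimal subtree T|_S containing S
  inSub : List (Fin N) → Fin N → Bool
  inSub S e = isEdge e ∧ (any (λ x → below x e) S ∧ any (λ x → not (below x e)) S)

  degIn : (Fin N → Bool) → Fin N → ℕ
  degIn sel x = countFin (λ e → sel e ∧ incident x e)

  degree : Fin N → ℕ
  degree = degIn isEdge

  IsLeaf : Fin N → Set
  IsLeaf x = degree x ≡ 1

  IsNode : Fin N → Set
  IsNode x = 2 ℕ.< degree x

  Essential : Set
  Essential = ∀ x → degree x ≢ 2

  OnTwig : Fin N → Set
  OnTwig e = ∃[ F ] ∃[ Nd ] (IsLeaf F × IsNode Nd ×
               (∀ x → OnPathV F Nd x → x ≢ Nd → ¬ IsNode x) ×
               T (onPathE F Nd e))

  Internal : Fin N → Set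
  Internal e = T (isEdge e) × ¬ OnTwig e

  NeighboursIn : List (Fin N) → Fin N → Fin N → Set
  NeighboursIn S a b =
    ∃[ x ] ((OnPathV a b x × 2 ℕ.< degIn (inSub S) x) ×
            (∀ y → OnPathV a b y → 2 ℕ.< degIn (inSub S) y → y ≡ x))

  Quartet : Fin N → Fin N → Fin N → Fin N → Set
  Quartet i j l m =
    NeighboursIn S i j × NeighboursIn S l m × ¬ NeighboursIn S i l
    where S = i ∷ j ∷ l ∷ m ∷ []

  LeafSet : ∀ {n} → (Fin n → Fin N) → Set
  LeafSet leaf = Injective _≡_ _≡_ leaf × (∀ x → IsLeaf x ⇔ (∃[ i ] leaf i ≡ x))

module Weighted (R : RealField) where
  open RealField R

  sumFin : ∀ {N} → (Fin N → ℝ) → ℝ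
  sumFin {zero} f = 0ℝ
  sumFin {suc N} f = f zero + sumFin (λ i → f (suc i))

  module _ {N : ℕ} (t : Tree N) (w : Fin N → ℝ) where
    D : List (Fin N) → ℝ
    D I = sumFin (λ e → if inSub t I e then w e else 0ℝ)

    InternalNonzero : Set
    InternalNonzero = ∀ e → Internal t e → w e ≢ 0ℝ

    module _ {n : ℕ} (leaf : Fin n → Fin N) where
      D₃ : Fin n → Fin n → Fin n → ℝ
      D₃ a b c = D (leaf a ∷ leaf b ∷ leaf c ∷ [])

      Outside : Fin n → Fin n → Fin n → Fin n → Fin n → Set
      Outside i j l m r = r ≢ i × r ≢ j × r ≢ l × r ≢ m

      IneqA : Fin n → Fin n → Fin n → Fin n → Fin n → Set
      IneqA i j l m r = D₃ i j l + D₃ m r l ≢ D₃ i r l + D₃ m j l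

      CondA : Fin n → Fin n → Fin n → Fin n → Set
      CondA i j l m = ∃[ r ] (Outside i j l m r ×
        IneqA i j l m r × IneqA j i l m r × IneqA i j m l r × IneqA j i m l r)

      CondB : Fin n → Fin n → Fin n → Fin n → Set
      CondB i j l m = ∀ r → Outside i j l m r →
        (D₃ i j r + D₃ m l r ≢ D₃ i m r + D₃ j l r) ×
        (D₃ i j r + D₃ m l r ≢ D₃ i l r + D₃ j m r)

-- Both conditions are read edge by edge. A difference D{a,b,s} + D{c,d,s} - D{a,c,s} - D{b,d,s}
-- is a sum over the edges e of w e times an integer determined by the sides of e on which the
-- five leaves lie, and this integer vanishes unless e splits a, b, c, d into two pairs. So every
-- inequality of (a) or (b) yields an edge splitting four of the leaves, and since two crossing
-- splits cannot both occur in a tree, the conditions force an edge separating {i, j} from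
-- {l, m}, that is, the quartet.
-- Conversely, given the quartet, let x be the median of i, j, l and g the edge at x towards l
-- and m, with far end q. Both ends of g are nodes (P is essential), so g is internal and
-- w g ≠ 0. If l and m lie in different branches at q, then g is the only edge contributing to
-- the inequalities of (b), whatever r is; otherwise a leaf r behind a third edge at q makes g
-- the only edge contributing to the four inequalities of (a).

module Submission where

open import Defs
open import Level using (0ℓ)
open import Data.Nat using (ℕ; zero; suc; _∸_; z≤n; s≤s; _≤_; _<_)
import Data.Nat as ℕ
open import Data.Nat.Properties using (≤-refl; ≤-trans; <-≤-trans; ≤-<-trans; ≤-reflexive; <⇒≤; <-irrefl; <-asym; ≤-total; m∸n+n≡m; +-suc; ≤-pred; n<1+n; n≤1+n; ≰⇒>; _≤?_; _<?_; ≮⇒≥; m≤n⇒m<n∨m≡n)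
open import Data.Fin using (Fin; zero; suc; toℕ; punchIn)
open import Data.Fin.Properties using (_≟_; pigeonhole; toℕ<n; suc-injective; ¬∀⟶∃¬; <⇒≢; punchInᵢ≢i)
open import Data.Bool using (Bool; true; false; T; not; _∧_; _∨_; _xor_; if_then_else_)
import Data.Bool as Bool
open import Data.Bool.Properties using (T-∧; T-∨; T-≡; T-not-≡; ¬-not)
open import Data.List using (List; []; _∷_; upTo)
open import Data.List.Membership.Propositional using (_∈_; find; lose)
open import Data.List.Membership.Propositional.Properties using (∈-upTo⁺)
open import Data.List.Relation.Unary.Any using (here; there)
open import Data.List.Relation.Unary.Any.Properties using (any⁺; any⁻)
open import Data.Product using (Σ; ∃-syntax; _×_; _,_; proj₁; proj₂)
open import Data.Sum using (_⊎_; inj₁; inj₂; [_,_]′)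
import Data.Sum as Sum
open import Data.Empty using (⊥; ⊥-elim)
open import Function.Base using (id)
open import Function.Bundles using (Equivalence; _⇔_; mk⇔)
open import Algebra.Bundles using (CommutativeRing)
import Algebra.Properties.CommutativeMonoid.Sum as MonoidSum
import Algebra.Properties.CommutativeSemigroup as SemigroupProperties
import Algebra.Properties.Group as GroupProperties
import Algebra.Properties.Monoid.Mult as MultProperties
open import Relation.Binary.PropositionalEquality using (_≡_; _≢_; refl; sym; trans; cong; cong₂; subst; module ≡-Reasoning)
open import Relation.Nullary using (¬_; yes; no; Dec; ¬?; _×-dec_; _⊎-dec_; _→-dec_)
open import Relation.Nullary.Decidable using (⌊_⌋; toWitness; fromWitness; toWitnessFalse; fromWitnessFalse; T?)

open Equivalence using (to; from)

T-true : ∀ {b} → b ≡ true → T b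
T-true = from T-≡

¬T-false : ∀ {b} → b ≡ false → ¬ T b
¬T-false refl ()

T-xor : ∀ {p q} → T (p xor q) ⇔ (p ≢ q)
T-xor {true} {true} = mk⇔ (λ ()) (λ p≢q → p≢q refl)
T-xor {true} {false} = mk⇔ (λ _ ()) _
T-xor {false} {true} = mk⇔ (λ _ ()) _
T-xor {false} {false} = mk⇔ (λ ()) (λ p≢q → p≢q refl)

≢-≢⇒≡ : ∀ {p q r : Bool} → p ≢ q → r ≢ q → p ≡ r
≢-≢⇒≡ p≢q r≢q = trans (¬-not p≢q) (sym (¬-not r≢q))

Bool-≢-cases : ∀ {p q} → p ≢ q → (p ≡ true × q ≡ false) ⊎ (p ≡ false × q ≡ true)
Bool-≢-cases {true} {true} p≢q = ⊥-elim (p≢q refl)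
Bool-≢-cases {true} {false} _ = inj₁ (refl , refl)
Bool-≢-cases {false} {true} _ = inj₂ (refl , refl)
Bool-≢-cases {false} {false} p≢q = ⊥-elim (p≢q refl)

1≤countFin : ∀ {N} (f : Fin N → Bool) {e} → T (f e) → 1 ≤ countFin f
1≤countFin f {zero} fe with f zero
... | true = s≤s z≤n
1≤countFin f {suc e} fe with f zero
... | true = s≤s z≤n
... | false = 1≤countFin (λ i → f (suc i)) fe

2≤countFin : ∀ {N} (f : Fin N → Bool) {e₁ e₂} → e₁ ≢ e₂ → T (f e₁) → T (f e₂) → 2 ≤ countFin f
2≤countFin f {zero} {zero} e₁≢e₂ _ _ = ⊥-elim (e₁≢e₂ refl)
2≤countFin f {zero} {suc e₂} _ _ fe₂ with f zero
... | true = s≤s (1≤countFin (λ i → f (suc i)) fe₂)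
2≤countFin f {suc e₁} {zero} _ fe₁ _ with f zero
... | true = s≤s (1≤countFin (λ i → f (suc i)) fe₁)
2≤countFin f {suc e₁} {suc e₂} e₁≢e₂ fe₁ fe₂ with f zero
... | true = ≤-trans (2≤countFin (λ i → f (suc i)) (λ e → e₁≢e₂ (cong suc e)) fe₁ fe₂) (n≤1+n _)
... | false = 2≤countFin (λ i → f (suc i)) (λ e → e₁≢e₂ (cong suc e)) fe₁ fe₂

3≤countFin : ∀ {N} (f : Fin N → Bool) {e₁ e₂ e₃} → e₁ ≢ e₂ → e₁ ≢ e₃ → e₂ ≢ e₃ →
             T (f e₁) → T (f e₂) → T (f e₃) → 3 ≤ countFin f
3≤countFin f {zero} {zero} n₁₂ _ _ _ _ _ = ⊥-elim (n₁₂ refl)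
3≤countFin f {zero} {suc _} {zero} _ n₁₃ _ _ _ _ = ⊥-elim (n₁₃ refl)
3≤countFin f {suc _} {zero} {zero} _ _ n₂₃ _ _ _ = ⊥-elim (n₂₃ refl)
3≤countFin f {zero} {suc _} {suc _} _ _ n₂₃ _ h₂ h₃ with f zero
... | true = s≤s (2≤countFin (λ i → f (suc i)) (λ e → n₂₃ (cong suc e)) h₂ h₃)
3≤countFin f {suc _} {zero} {suc _} _ n₁₃ _ h₁ _ h₃ with f zero
... | true = s≤s (2≤countFin (λ i → f (suc i)) (λ e → n₁₃ (cong suc e)) h₁ h₃)
3≤countFin f {suc _} {suc _} {zero} n₁₂ _ _ h₁ h₂ _ with f zero
... | true = s≤s (2≤countFin (λ i → f (suc i)) (λ e → n₁₂ (cong suc e)) h₁ h₂)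
3≤countFin f {suc _} {suc _} {suc _} n₁₂ n₁₃ n₂₃ h₁ h₂ h₃ with f zero
... | true = ≤-trans (3≤countFin (λ i → f (suc i)) (λ e → n₁₂ (cong suc e)) (λ e → n₁₃ (cong suc e)) (λ e → n₂₃ (cong suc e)) h₁ h₂ h₃) (n≤1+n _)
... | false = 3≤countFin (λ i → f (suc i)) (λ e → n₁₂ (cong suc e)) (λ e → n₁₃ (cong suc e)) (λ e → n₂₃ (cong suc e)) h₁ h₂ h₃

countFin-witness : ∀ {N} (f : Fin N → Bool) → 1 ≤ countFin f → ∃[ e ] T (f e)
countFin-witness {suc N} f h with f zero in eq
... | true = zero , T-true eq
... | false with countFin-witness (λ i → f (suc i)) h
... | e , fe = suc e , fe

countFin-witness₂ : ∀ {N} (f : Fin N → Bool) → 2 ≤ countFin f →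
                    ∃[ e₁ ] ∃[ e₂ ] (e₁ ≢ e₂ × T (f e₁) × T (f e₂))
countFin-witness₂ {suc N} f h with f zero in eq
... | true with countFin-witness (λ i → f (suc i)) (≤-pred h)
... | e , fe = zero , suc e , (λ ()) , T-true eq , fe
countFin-witness₂ {suc N} f h | false with countFin-witness₂ (λ i → f (suc i)) h
... | e₁ , e₂ , e₁≢e₂ , fe₁ , fe₂ = suc e₁ , suc e₂ , (λ e → e₁≢e₂ (suc-injective e)) , fe₁ , fe₂

countFin-witness₃ : ∀ {N} (f : Fin N → Bool) → 3 ≤ countFin f →
                    ∃[ e₁ ] ∃[ e₂ ] ∃[ e₃ ] ((e₁ ≢ e₂ × e₁ ≢ e₃ × e₂ ≢ e₃) × T (f e₁) × T (f e₂) × T (f e₃))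
countFin-witness₃ {suc N} f h with f zero in eq
... | true with countFin-witness₂ (λ i → f (suc i)) (≤-pred h)
... | e₁ , e₂ , e₁≢e₂ , fe₁ , fe₂ =
  zero , suc e₁ , suc e₂ , ((λ ()) , (λ ()) , (λ e → e₁≢e₂ (suc-injective e))) , T-true eq , fe₁ , fe₂
countFin-witness₃ {suc N} f h | false with countFin-witness₃ (λ i → f (suc i)) h
... | e₁ , e₂ , e₃ , (n₁₂ , n₁₃ , n₂₃) , fe₁ , fe₂ , fe₃ =
  suc e₁ , suc e₂ , suc e₃ ,
  ((λ e → n₁₂ (suc-injective e)) , (λ e → n₁₃ (suc-injective e)) , (λ e → n₂₃ (suc-injective e))) ,
  fe₁ , fe₂ , fe₃

countFin-mono : ∀ {N} (f g : Fin N → Bool) → (∀ e → T (f e) → T (g e)) → countFin f ≤ countFin g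
countFin-mono {zero} f g f⊆g = z≤n
countFin-mono {suc N} f g f⊆g with f zero in ef | g zero in eg
... | true | true = s≤s (countFin-mono _ _ (λ e → f⊆g (suc e)))
... | true | false = ⊥-elim (¬T-false eg (f⊆g zero (T-true ef)))
... | false | true = ≤-trans (countFin-mono _ _ (λ e → f⊆g (suc e))) (n≤1+n _)
... | false | false = countFin-mono _ _ (λ e → f⊆g (suc e))

countFin-singleton : ∀ {N} (f : Fin N → Bool) e → T (f e) → (∀ e′ → T (f e′) → e′ ≡ e) → countFin f ≡ 1
countFin-singleton f e fe only with countFin f in eq
... | zero = ⊥-elim (<-irrefl refl (subst (1 ≤_) eq (1≤countFin f fe)))
... | suc zero = refl
... | suc (suc _) with countFin-witness₂ f (subst (2 ≤_) (sym eq) (s≤s (s≤s z≤n)))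
... | e₁ , e₂ , e₁≢e₂ , fe₁ , fe₂ = ⊥-elim (e₁≢e₂ (trans (only e₁ fe₁) (sym (only e₂ fe₂))))

countFin-pair : ∀ {N} (f : Fin N → Bool) e₁ e₂ → e₁ ≢ e₂ → T (f e₁) → T (f e₂) →
                (∀ e → T (f e) → e ≡ e₁ ⊎ e ≡ e₂) → countFin f ≡ 2
countFin-pair f e₁ e₂ e₁≢e₂ fe₁ fe₂ only with countFin f in eq
... | zero = ⊥-elim (absurd (subst (2 ≤_) eq (2≤countFin f e₁≢e₂ fe₁ fe₂)))
  where absurd : ¬ 2 ≤ 0
        absurd ()
... | suc zero = ⊥-elim (absurd (subst (2 ≤_) eq (2≤countFin f e₁≢e₂ fe₁ fe₂)))
  where absurd : ¬ 2 ≤ 1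
        absurd (s≤s ())
... | suc (suc zero) = refl
... | suc (suc (suc _)) with countFin-witness₃ f (subst (3 ≤_) (sym eq) (s≤s (s≤s (s≤s z≤n))))
... | a , b , c , (a≢b , a≢c , b≢c) , fa , fb , fc with only a fa | only b fb | only c fc
... | inj₁ p | inj₁ q | _ = ⊥-elim (a≢b (trans p (sym q)))
... | inj₂ p | inj₂ q | _ = ⊥-elim (a≢b (trans p (sym q)))
... | inj₁ p | _ | inj₁ r = ⊥-elim (a≢c (trans p (sym r)))
... | inj₂ p | _ | inj₂ r = ⊥-elim (a≢c (trans p (sym r)))
... | _ | inj₁ q | inj₁ r = ⊥-elim (b≢c (trans q (sym r)))
... | _ | inj₂ q | inj₂ r = ⊥-elim (b≢c (trans q (sym r)))

argmax : ∀ {N} (p : Fin N → Bool) (f : Fin N → ℕ) →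
         (∃[ z ] (T (p z) × ∀ y → T (p y) → f y ≤ f z)) ⊎ (∀ y → ¬ T (p y))
argmax {zero} p f = inj₂ (λ ())
argmax {suc N} p f with argmax (λ i → p (suc i)) (λ i → f (suc i)) | p zero in eq
... | inj₂ none | false = inj₂ λ { zero h → ¬T-false eq h ; (suc y) h → none y h }
... | inj₂ none | true = inj₁ (zero , T-true eq , λ { zero h → ≤-refl ; (suc y) h → ⊥-elim (none y h) })
... | inj₁ (z , pz , max) | false = inj₁ (suc z , pz , λ { zero h → ⊥-elim (¬T-false eq h) ; (suc y) h → max y h })
... | inj₁ (z , pz , max) | true with f zero ≤? f (suc z)
... | yes le = inj₁ (suc z , pz , λ { zero h → le ; (suc y) h → max y h })
... | no nle = inj₁ (zero , T-true eq , λ { zero h → ≤-refl ; (suc y) h → ≤-trans (max y h) (<⇒≤ (≰⇒> nle)) })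

argmax-nonempty : ∀ {N} (p : Fin N → Bool) (f : Fin N → ℕ) {w} → T (p w) →
                  ∃[ z ] (T (p z) × ∀ y → T (p y) → f y ≤ f z)
argmax-nonempty p f pw with argmax p f
... | inj₁ r = r
... | inj₂ none = ⊥-elim (none _ pw)

module Ancestry {N : ℕ} (t : Tree N) where
  open Tree t

  iter-suc : ∀ k u → iter t (suc k) u ≡ iter t k (parent u)
  iter-suc zero u = refl
  iter-suc (suc k) u = cong parent (iter-suc k u)

  iter-+ : ∀ k m u → iter t (k ℕ.+ m) u ≡ iter t k (iter t m u)
  iter-+ zero m u = refl
  iter-+ (suc k) m u = cong parent (iter-+ k m u)

  iter-root : ∀ k → iter t k root ≡ root
  iter-root zero = refl
  iter-root (suc k) = trans (cong parent (iter-root k)) parent-root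

  parent-≢ : ∀ {u} → u ≢ root → parent u ≢ u
  parent-≢ {u} u≢root e = <-irrefl (cong depth e) (depth-dec u u≢root)

  child-deeper : ∀ {c v} → c ≢ root → parent c ≡ v → depth v < depth c
  child-deeper {c} c≢root refl = depth-dec c c≢root

  depth-iter : ∀ k u → depth (iter t k u) ≤ depth u
  depth-iter zero u = ≤-refl
  depth-iter (suc k) u with iter t k u ≟ root
  ... | yes r = subst (λ v → depth v ≤ depth u) (sym (trans (cong parent r) (trans parent-root (sym r)))) (depth-iter k u)
  ... | no nr = ≤-trans (<⇒≤ (depth-dec _ nr)) (depth-iter k u)

  depth-iter-suc : ∀ k u → u ≢ root → depth (iter t (suc k) u) < depth u
  depth-iter-suc k u u≢root =
    ≤-<-trans (≤-reflexive (cong depth (iter-suc k u))) (≤-<-trans (depth-iter k (parent u)) (depth-dec u u≢root))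

  iter-cycle : ∀ k w → iter t (suc k) w ≡ w → w ≡ root
  iter-cycle k w e with w ≟ root
  ... | yes r = r
  ... | no nr = ⊥-elim (<-irrefl (cong depth e) (depth-iter-suc k w nr))

  -- Among the N + 1 iterates two coincide, and a cycle of parents can only sit at the root.
  reaches-root : ∀ u → ∃[ k ] (k < N × iter t k u ≡ root)
  reaches-root u with pigeonhole (n<1+n N) (λ (k : Fin (suc N)) → iter t (toℕ k) u)
  ... | i , j , i<j , e = toℕ i , <-≤-trans i<j (≤-pred (toℕ<n j)) , iter-cycle d _ cycle
    where
    d = toℕ j ∸ suc (toℕ i)
    cycle : iter t (suc d) (iter t (toℕ i) u) ≡ iter t (toℕ i) u
    cycle = trans (sym (iter-+ (suc d) (toℕ i) u))
              (trans (cong (λ k → iter t k u) (trans (sym (+-suc d (toℕ i))) (m∸n+n≡m i<j))) (sym e))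

  Below : Fin N → Fin N → Set
  Below u v = ∃[ k ] (iter t k u ≡ v)

  below-sound : ∀ {u v} → T (below t u v) → Below u v
  below-sound {u} {v} h with find (any⁻ _ (upTo N) h)
  ... | k , _ , q = k , toWitness q

  Below-refl : ∀ u → Below u u
  Below-refl u = 0 , refl

  Below-trans : ∀ {u v w} → Below u v → Below v w → Below u w
  Below-trans {u} (k , refl) (m , refl) = m ℕ.+ k , iter-+ m k u

  Below-parent : ∀ u → Below u (parent u)
  Below-parent u = 1 , refl

  Below-root : ∀ u → Below u root
  Below-root u with reaches-root u
  ... | k , _ , e = k , e

  iter-stays-root : ∀ k m u → iter t m u ≡ root → iter t (k ℕ.+ m) u ≡ root
  iter-stays-root k m u e = trans (iter-+ k m u) (trans (cong (iter t k) e) (iter-root k))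

  below-complete : ∀ {u v} → Below u v → T (below t u v)
  below-complete {u} {v} (k , e) with k <? N
  ... | yes k<N = any⁺ _ (lose (∈-upTo⁺ k<N) (fromWitness e))
  ... | no k≮N with reaches-root u
  ... | k′ , k′<N , r = any⁺ _ (lose (∈-upTo⁺ k′<N) (fromWitness (trans r (trans (sym rootₖ) e))))
    where
    rootₖ : iter t k u ≡ root
    rootₖ = subst (λ z → iter t z u ≡ root) (m∸n+n≡m (<⇒≤ (<-≤-trans k′<N (≮⇒≥ k≮N)))) (iter-stays-root (k ∸ k′) k′ u r)

  Below? : ∀ u v → Dec (Below u v)
  Below? u v with below t u v in eq
  ... | true = yes (below-sound (T-true eq))
  ... | false = no (λ b → ¬T-false eq (below-complete b))

  Below-up : ∀ {u v} → Below u v → u ≢ v → Below (parent u) v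
  Below-up (zero , e) u≢v = ⊥-elim (u≢v e)
  Below-up {u} (suc k , e) _ = k , trans (sym (iter-suc k u)) e

  Below-comparable : ∀ {x u v} → Below x u → Below x v → Below u v ⊎ Below v u
  Below-comparable {x} (a , refl) (b , refl) with ≤-total a b
  ... | inj₁ a≤b = inj₁ (b ∸ a , trans (sym (iter-+ (b ∸ a) a x)) (cong (λ k → iter t k x) (m∸n+n≡m a≤b)))
  ... | inj₂ b≤a = inj₂ (a ∸ b , trans (sym (iter-+ (a ∸ b) b x)) (cong (λ k → iter t k x) (m∸n+n≡m b≤a)))

  Below-depth : ∀ {u v} → Below u v → u ≢ v → depth v < depth u
  Below-depth (zero , e) u≢v = ⊥-elim (u≢v e)
  Below-depth {u} (suc k , refl) u≢v with u ≟ root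
  ... | yes refl = ⊥-elim (u≢v (sym (iter-root (suc k))))
  ... | no u≢root = depth-iter-suc k u u≢root

  Below-antisym : ∀ {u v} → Below u v → Below v u → u ≡ v
  Below-antisym {u} {v} p q with u ≟ v
  ... | yes e = e
  ... | no u≢v = ⊥-elim (<-asym (Below-depth p u≢v) (Below-depth q (λ e → u≢v (sym e))))

  Below-root⇒root : ∀ {v} → Below root v → v ≡ root
  Below-root⇒root b = Below-antisym (Below-root _) b

  subtrees-nested-or-disjoint : ∀ e f → (∀ v → Below v e → Below v f) ⊎ (∀ v → Below v f → Below v e) ⊎
                                         (∀ v → Below v e → ¬ Below v f)
  subtrees-nested-or-disjoint e f with Below? e f | Below? f e
  ... | yes ef | _ = inj₁ (λ v ve → Below-trans ve ef)
  ... | no _ | yes fe = inj₂ (inj₁ (λ v vf → Below-trans vf fe))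
  ... | no ¬ef | no ¬fe = inj₂ (inj₂ (λ v ve vf → [ ¬ef , ¬fe ]′ (Below-comparable ve vf)))

  lowest-common-ancestor : ∀ a b → ∃[ z ] (Below a z × Below b z × (∀ y → Below a y → Below b y → depth y ≤ depth z))
  lowest-common-ancestor a b with argmax-nonempty (λ y → below t a y ∧ below t b y) depth
                                  (from T-∧ (below-complete (Below-root a) , below-complete (Below-root b)))
  ... | z , common , deepest =
    z , below-sound (proj₁ both) , below-sound (proj₂ both) ,
    (λ y ay by → deepest y (from T-∧ (below-complete ay , below-complete by)))
    where both = to T-∧ common

module Branches {N : ℕ} (t : Tree N) where
  open Tree t
  open Ancestry t

  -- e is the first edge on the path from x to a; edges are named by their lower endpoint.
  Toward : Fin N → Fin N → Fin N → Set
  Toward x e a = (e ≡ x × x ≢ root × ¬ Below a x) ⊎ (e ≢ x × parent e ≡ x × Below a e)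

  toward-≢ : ∀ {x e a} → Toward x e a → a ≢ x
  toward-≢ (inj₁ (_ , _ , nb)) refl = nb (Below-refl _)
  toward-≢ (inj₂ (ne , pe , b)) refl = ne (Below-antisym (subst (Below _) pe (Below-parent _)) b)

  toward-edge : ∀ {x e a} → Toward x e a → e ≢ root
  toward-edge (inj₁ (refl , nr , _)) = nr
  toward-edge (inj₂ (ne , pe , b)) refl = ne (trans (sym parent-root) pe)

  child-toward : ∀ k a {x} → iter t (suc k) a ≡ x → a ≢ x → ∃[ c ] (c ≢ x × parent c ≡ x × Below a c)
  child-toward zero a e ne = a , ne , e , Below-refl a
  child-toward (suc k) a {x} e ne with parent a ≟ x
  ... | yes pe = a , ne , pe , Below-refl a
  ... | no pne with child-toward k (parent a) (trans (sym (iter-suc (suc k) a)) e) pne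
  ... | c , cne , cp , b = c , cne , cp , Below-trans (Below-parent a) b

  toward-exists : ∀ {x a} → a ≢ x → ∃[ e ] Toward x e a
  toward-exists {x} {a} ne with Below? a x
  ... | yes (zero , e) = ⊥-elim (ne e)
  ... | yes (suc k , e) with child-toward k a e ne
  ... | c , cne , cp , b = c , inj₂ (cne , cp , b)
  toward-exists {x} {a} ne | no nb = x , inj₁ (refl , (λ xr → nb (subst (Below a) (sym xr) (Below-root a))) , nb)

  toward-unique : ∀ {x e e' a} → Toward x e a → Toward x e' a → e ≡ e'
  toward-unique (inj₁ (refl , _)) (inj₁ (refl , _)) = refl
  toward-unique (inj₁ (refl , _ , nb)) (inj₂ (ne , pe , b)) = ⊥-elim (nb (Below-trans b (subst (Below _) pe (Below-parent _))))
  toward-unique (inj₂ (ne , pe , b)) (inj₁ (refl , _ , nb)) = ⊥-elim (nb (Below-trans b (subst (Below _) pe (Below-parent _))))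
  toward-unique {x} {e} {e'} (inj₂ (ne , pe , b)) (inj₂ (ne' , pe' , b')) with e ≟ e'
  ... | yes eq = eq
  ... | no neq with Below-comparable b b'
  ... | inj₁ ee' = ⊥-elim (ne' (Below-antisym (subst (Below e') pe' (Below-parent e')) (subst (λ z → Below z e') pe (Below-up ee' neq))))
  ... | inj₂ e'e = ⊥-elim (ne (Below-antisym (subst (Below e) pe (Below-parent e)) (subst (λ z → Below z e) pe' (Below-up e'e (λ q → neq (sym q))))))

  SameBranch : Fin N → Fin N → Fin N → Set
  SameBranch x a b = ∃[ e ] (Toward x e a × Toward x e b)

  sameBranch? : ∀ {x a b} → a ≢ x → b ≢ x → Dec (SameBranch x a b)
  sameBranch? {x} {a} {b} na nb with toward-exists na | toward-exists nb
  ... | ea , fa | eb , fb with ea ≟ eb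
  ... | yes refl = yes (ea , fa , fb)
  ... | no ne = no (λ { (e , fa' , fb') → ne (trans (toward-unique fa fa') (toward-unique fb' fb)) })

  sameBranch-refl : ∀ {x a} → a ≢ x → SameBranch x a a
  sameBranch-refl a≢x = let (e , p) = toward-exists a≢x in e , p , p

  ¬sameBranch⇒≢ : ∀ {x a b} → a ≢ x → ¬ SameBranch x a b → a ≢ b
  ¬sameBranch⇒≢ a≢x ¬ab refl = ¬ab (sameBranch-refl a≢x)

  sameBranch-sym : ∀ {x a b} → SameBranch x a b → SameBranch x b a
  sameBranch-sym (e , p , q) = e , q , p

  ¬sameBranch-sym : ∀ {x a b} → ¬ SameBranch x a b → ¬ SameBranch x b a
  ¬sameBranch-sym ¬ab ba = ¬ab (sameBranch-sym ba)

  sameBranch-trans : ∀ {x a b c} → SameBranch x a b → SameBranch x b c → SameBranch x a c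
  sameBranch-trans (e , p , q) (e' , q' , r) with toward-unique q q'
  ... | refl = e , p , r

  sameBranch-flip : ∀ {x y a} → x ≢ y → a ≢ x → a ≢ y → ¬ SameBranch y a x → SameBranch x a y
  sameBranch-flip {x} {y} {a} xy ax ay nsd with Below? x y
  ... | yes xy-b with toward-exists {y} {x} xy
  ...   | c , inj₁ (refl , _ , nb) = ⊥-elim (nb xy-b)
  ...   | c , inj₂ (cne , cp , xc) = x , inj₁ (refl , xnr , nax) , inj₁ (refl , xnr , nyx)
    where
    xnr : x ≢ root
    xnr refl = xy (sym (Below-root⇒root xy-b))
    nyx : ¬ Below y x
    nyx b = xy (Below-antisym xy-b b)
    nax : ¬ Below a x
    nax b = nsd (c , inj₂ (cne , cp , Below-trans b xc) , inj₂ (cne , cp , xc))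
  sameBranch-flip {x} {y} {a} xy ax ay nsd | no nxy with toward-exists {y} {a} ay
  ... | .y , inj₁ (refl , ynr , nay) = ⊥-elim (nsd (y , inj₁ (refl , ynr , nay) , inj₁ (refl , ynr , nxy)))
  ... | c , inj₂ (cne , cp , ac) with Below? y x
  ...   | yes yx with toward-exists {x} {y} (λ q → xy (sym q))
  ...     | g , inj₁ (refl , _ , nb) = ⊥-elim (nb yx)
  ...     | g , inj₂ (gne , gp , yg) = g , inj₂ (gne , gp , Below-trans (Below-trans ac (subst (Below c) cp (Below-parent c))) yg) , inj₂ (gne , gp , yg)
  sameBranch-flip {x} {y} {a} xy ax ay nsd | no nxy | c , inj₂ (cne , cp , ac) | no nyx =
    x , inj₁ (refl , xnr , nax) , inj₁ (refl , xnr , nyx)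
    where
    xnr : x ≢ root
    xnr refl = nyx (Below-root y)
    ay' : Below a y
    ay' = Below-trans ac (subst (Below c) cp (Below-parent c))
    nax : ¬ Below a x
    nax b with Below-comparable b ay'
    ... | inj₁ q = nxy q
    ... | inj₂ q = nyx q

  Adjacent : Fin N → Fin N → Fin N → Set
  Adjacent x g q = (g ≡ x × q ≡ parent x × x ≢ root) ⊎ (g ≢ x × parent g ≡ x × q ≡ g)

  toward-adjacent : ∀ {x g a} → Toward x g a → ∃[ q ] Adjacent x g q
  toward-adjacent {x} (inj₁ (refl , nr , _)) = parent x , inj₁ (refl , refl , nr)
  toward-adjacent {x} {g} (inj₂ (ne , pe , _)) = g , inj₂ (ne , pe , refl)

  adjacent-≢ : ∀ {x g q} → Adjacent x g q → q ≢ x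
  adjacent-≢ (inj₁ (refl , refl , nr)) e = parent-≢ nr e
  adjacent-≢ (inj₂ (ne , pe , refl)) = ne

  adjacent-toward : ∀ {x g q} → Adjacent x g q → Toward x g q
  adjacent-toward {x} (inj₁ (refl , refl , nr)) = inj₁ (refl , nr , λ b → parent-≢ nr (Below-antisym b (Below-parent x)))
  adjacent-toward {x} {g} (inj₂ (ne , pe , refl)) = inj₂ (ne , pe , Below-refl g)

  adjacent-back : ∀ {x g q} → Adjacent x g q → Toward q g x
  adjacent-back {x} (inj₁ (refl , refl , nr)) = inj₂ ((λ e → parent-≢ nr (sym e)) , refl , Below-refl x)
  adjacent-back {x} {g} (inj₂ (ne , refl , refl)) = inj₁ (refl , gnr , nxg)
    where
    gnr : g ≢ root
    gnr refl = ne (sym parent-root)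
    nxg : ¬ Below (parent g) g
    nxg b = ne (Below-antisym (Below-parent g) b)

  beyond⇒¬sameBranch : ∀ {x g q a} → Adjacent x g q → Toward x g a → ¬ SameBranch q a x
  beyond⇒¬sameBranch {x} (inj₁ (refl , refl , nr)) (inj₁ (_ , _ , nax)) (e , fa , fx) with toward-unique fx (adjacent-back (inj₁ (refl , refl , nr)))
  ... | refl with fa
  ... | inj₁ (e1 , _) = parent-≢ nr (sym e1)
  ... | inj₂ (_ , _ , b) = nax b
  beyond⇒¬sameBranch (inj₁ (refl , refl , nr)) (inj₂ (ne , _)) _ = ne refl
  beyond⇒¬sameBranch (inj₂ (ne , pe , refl)) (inj₁ (e , _)) _ = ne e
  beyond⇒¬sameBranch {x} {g} (inj₂ (ne , refl , refl)) (inj₂ (_ , _ , ag)) (e , fa , fx) with toward-unique fx (adjacent-back (inj₂ (ne , refl , refl)))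
  ... | refl with fa
  ... | inj₁ (_ , _ , nag) = nag ag
  ... | inj₂ (e1 , _) = e1 refl

  below⇒sameBranch : ∀ {f x a} → f ≢ root → Below a f → ¬ Below x f → SameBranch x a f
  below⇒sameBranch {f} {x} {a} fnr af nxf with a ≟ f
  ... | yes refl = let (e , p) = toward-exists xf in e , p , p
    where xf : f ≢ x
          xf refl = nxf (Below-refl f)
  ... | no ne = sameBranch-flip xf ax ne nsd
    where
    xf : x ≢ f
    xf refl = nxf (Below-refl x)
    ax : a ≢ x
    ax refl = nxf af
    nsd : ¬ SameBranch f a x
    nsd (e , fa , fx) with toward-unique fx (inj₁ (refl , fnr , nxf))
    ... | refl with fa
    ... | inj₁ (_ , _ , naf) = naf af
    ... | inj₂ (e1 , _) = e1 refl

  above⇒sameBranch : ∀ {f x a} → f ≢ root → ¬ Below a f → Below x f → SameBranch x a (parent f)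
  above⇒sameBranch {f} {x} {a} fnr naf xf with a ≟ parent f
  ... | yes refl = let (e , p) = toward-exists px in e , p , p
    where px : parent f ≢ x
          px e = parent-≢ fnr (Below-antisym (subst (λ z → Below z f) (sym e) xf) (Below-parent f))
  ... | no ne = sameBranch-flip xp ax ne nsd
    where
    xp : x ≢ parent f
    xp e = parent-≢ fnr (Below-antisym (subst (λ z → Below z f) e xf) (Below-parent f))
    ax : a ≢ x
    ax refl = naf xf
    fp : f ≢ parent f
    fp e = parent-≢ fnr (sym e)
    nsd : ¬ SameBranch (parent f) a x
    nsd (e , fa , fx) with toward-unique fx (inj₂ (fp , refl , xf))
    ... | refl with fa
    ... | inj₁ (e1 , _) = fp e1
    ... | inj₂ (_ , _ , af) = naf af

  across-edge⇒sameBranch : ∀ {f x a b} → f ≢ root →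
         (Below a f × Below b f × ¬ Below x f) ⊎ (¬ Below a f × ¬ Below b f × Below x f) →
         SameBranch x a b
  across-edge⇒sameBranch fnr (inj₁ (af , bf , nxf)) = sameBranch-trans (below⇒sameBranch fnr af nxf) (sameBranch-sym (below⇒sameBranch fnr bf nxf))
  across-edge⇒sameBranch fnr (inj₂ (naf , nbf , xf)) = sameBranch-trans (above⇒sameBranch fnr naf xf) (sameBranch-sym (above⇒sameBranch fnr nbf xf))

  separating-adjacent : ∀ {x g q f} → Adjacent x g q →
           (Below x f × ¬ Below q f) ⊎ (¬ Below x f × Below q f) → f ≡ g
  separating-adjacent {x} {.x} {.(parent x)} {f} (inj₁ (refl , refl , nr)) (inj₁ (xf , npf)) with x ≟ f
  ... | yes e = sym e
  ... | no ne = ⊥-elim (npf (Below-up xf ne))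
  separating-adjacent {x} (inj₁ (refl , refl , nr)) (inj₂ (nxf , pf)) = ⊥-elim (nxf (Below-trans (Below-parent x) pf))
  separating-adjacent {x} {g} (inj₂ (ne , refl , refl)) (inj₁ (xf , ngf)) = ⊥-elim (ngf (Below-trans (Below-parent g) xf))
  separating-adjacent {x} {g} {.g} {f} (inj₂ (ne , refl , refl)) (inj₂ (nxf , gf)) with g ≟ f
  ... | yes e = sym e
  ... | no ne' = ⊥-elim (nxf (Below-up gf ne'))

module Sides {N : ℕ} (t : Tree N) where
  open Tree t
  open Ancestry t
  open Branches t

  below≡true : ∀ {v e} → Below v e → below t v e ≡ true
  below≡true b = to T-≡ (below-complete b)

  below≡false : ∀ {v e} → ¬ Below v e → below t v e ≡ false
  below≡false {v} {e} ¬b with below t v e in eq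
  ... | true = ⊥-elim (¬b (below-sound (T-true eq)))
  ... | false = refl

  below≡true⁻¹ : ∀ {v e} → below t v e ≡ true → Below v e
  below≡true⁻¹ eq = below-sound (T-true eq)

  below≡false⁻¹ : ∀ {v e} → below t v e ≡ false → ¬ Below v e
  below≡false⁻¹ eq b = ¬T-false eq (below-complete b)

  Incident : Fin N → Fin N → Set
  Incident x e = e ≢ root × (e ≡ x ⊎ parent e ≡ x)

  isEdge⇒ : ∀ {e} → T (isEdge t e) → e ≢ root
  isEdge⇒ = toWitnessFalse

  ⇒isEdge : ∀ {e} → e ≢ root → T (isEdge t e)
  ⇒isEdge = fromWitnessFalse

  incident⇒ : ∀ {x e} → T (incident t x e) → Incident x e
  incident⇒ {x} {e} h with to (T-∧ {isEdge t e}) h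
  ... | isE , ends with to (T-∨ {⌊ e ≟ x ⌋}) ends
  ... | inj₁ e≡x = isEdge⇒ isE , inj₁ (toWitness e≡x)
  ... | inj₂ pe≡x = isEdge⇒ isE , inj₂ (toWitness pe≡x)

  ⇒incident : ∀ {x e} → Incident x e → T (incident t x e)
  ⇒incident {x} {e} (e≢root , ends) = from T-∧ (⇒isEdge e≢root , from (T-∨ {⌊ e ≟ x ⌋}) (Sum.map fromWitness fromWitness ends))

  degreeEdge⇒ : ∀ {x e} → T (isEdge t e ∧ incident t x e) → Incident x e
  degreeEdge⇒ {x} {e} h = incident⇒ (proj₂ (to (T-∧ {isEdge t e}) h))

  ⇒degreeEdge : ∀ {x e} → Incident x e → T (isEdge t e ∧ incident t x e)
  ⇒degreeEdge i = from T-∧ (⇒isEdge (proj₁ i) , ⇒incident i)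

  toward-incident : ∀ {x e a} → Toward x e a → Incident x e
  toward-incident f@(inj₁ (refl , _)) = toward-edge f , inj₁ refl
  toward-incident f@(inj₂ (_ , pe≡x , _)) = toward-edge f , inj₂ pe≡x

  child-¬above : ∀ {x e} → e ≢ x → parent e ≡ x → ¬ Below x e
  child-¬above e≢x pe≡x xe = e≢x (Below-antisym (subst (Below _) pe≡x (Below-parent _)) xe)

  toward⇒below≢ : ∀ {x e a} → Toward x e a → below t a e ≢ below t x e
  toward⇒below≢ {x} (inj₁ (refl , _ , ¬ax)) eq with trans (sym (below≡false ¬ax)) (trans eq (below≡true (Below-refl x)))
  ... | ()
  toward⇒below≢ (inj₂ (e≢x , pe≡x , ae)) eq with trans (sym (below≡true ae)) (trans eq (below≡false (child-¬above e≢x pe≡x)))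
  ... | ()

  below≢⇒toward : ∀ {x e a} → Incident x e → below t a e ≢ below t x e → Toward x e a
  below≢⇒toward {x} (e≢root , inj₁ refl) ne =
    inj₁ (refl , e≢root , below≡false⁻¹ (trans (¬-not ne) (cong not (below≡true (Below-refl x)))))
  below≢⇒toward (e≢root , inj₂ pe≡x) ne = inj₂ (e≢x , pe≡x , below≡true⁻¹ (trans (¬-not ne) (cong not x-side)))
    where
    e≢x : _
    e≢x refl = parent-≢ e≢root pe≡x
    x-side = below≡false (child-¬above e≢x pe≡x)

  ¬toward⇒below≡ : ∀ {x e b} → Incident x e → ¬ Toward x e b → below t b e ≡ below t x e
  ¬toward⇒below≡ {x} {e} {b} inc ¬f with below t b e Bool.≟ below t x e
  ... | yes eq = eq
  ... | no ne = ⊥-elim (¬f (below≢⇒toward inc ne))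

  toward-below≡ : ∀ {x e a b} → Toward x e a → Toward x e b → below t a e ≡ below t b e
  toward-below≡ fa fb = ≢-≢⇒≡ (toward⇒below≢ fa) (toward⇒below≢ fb)

  toward-¬toward-below≢ : ∀ {x e a b} → Toward x e a → ¬ Toward x e b → below t a e ≢ below t b e
  toward-¬toward-below≢ fa ¬fb eq = toward⇒below≢ fa (trans eq (¬toward⇒below≡ (toward-incident fa) ¬fb))

  ¬toward-below≡ : ∀ {x e a b} → Incident x e → ¬ Toward x e a → ¬ Toward x e b → below t a e ≡ below t b e
  ¬toward-below≡ inc ¬fa ¬fb = trans (¬toward⇒below≡ inc ¬fa) (sym (¬toward⇒below≡ inc ¬fb))

  across-edgeᵇ⇒sameBranch : ∀ {e x a b} → e ≢ root → below t a e ≡ below t b e → below t x e ≢ below t a e → SameBranch x a b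
  across-edgeᵇ⇒sameBranch e≢root a≡b x≢a with Bool-≢-cases x≢a
  ... | inj₁ (x-in , a-out) = across-edge⇒sameBranch e≢root
          (inj₂ (below≡false⁻¹ a-out , below≡false⁻¹ (trans (sym a≡b) a-out) , below≡true⁻¹ x-in))
  ... | inj₂ (x-out , a-in) = across-edge⇒sameBranch e≢root
          (inj₁ (below≡true⁻¹ a-in , below≡true⁻¹ (trans (sym a≡b) a-in) , below≡false⁻¹ x-out))

  separating-adjacentᵇ : ∀ {x g q e} → Adjacent x g q → below t x e ≢ below t q e → e ≡ g
  separating-adjacentᵇ adj x≢q with Bool-≢-cases x≢q
  ... | inj₁ (x-in , q-out) = separating-adjacent adj (inj₁ (below≡true⁻¹ x-in , below≡false⁻¹ q-out))
  ... | inj₂ (x-out , q-in) = separating-adjacent adj (inj₂ (below≡false⁻¹ x-out , below≡true⁻¹ q-in))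

module Degrees {N : ℕ} (t : Tree N) where
  open Tree t
  open Ancestry t
  open Branches t
  open Sides t

  degree-≥2 : ∀ {x e₁ e₂} → Incident x e₁ → Incident x e₂ → e₁ ≢ e₂ → 2 ≤ degree t x
  degree-≥2 i₁ i₂ e₁≢e₂ = 2≤countFin _ e₁≢e₂ (⇒degreeEdge i₁) (⇒degreeEdge i₂)

  leaf-incident-unique : ∀ {x e₁ e₂} → IsLeaf t x → Incident x e₁ → Incident x e₂ → e₁ ≡ e₂
  leaf-incident-unique {x} {e₁} {e₂} leaf i₁ i₂ with e₁ ≟ e₂
  ... | yes eq = eq
  ... | no e₁≢e₂ = ⊥-elim (<-irrefl refl (subst (2 ≤_) leaf (degree-≥2 i₁ i₂ e₁≢e₂)))

  leaf-sameBranch : ∀ {x a b} → IsLeaf t x → a ≢ x → b ≢ x → SameBranch x a b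
  leaf-sameBranch leaf a≢x b≢x with toward-exists a≢x | toward-exists b≢x
  ... | ea , fa | eb , fb with leaf-incident-unique leaf (toward-incident fa) (toward-incident fb)
  ... | refl = ea , fa , fb

  leaf-≢-branching : ∀ {s x a b} → IsLeaf t s → a ≢ x → b ≢ x → ¬ SameBranch x a b → s ≢ x
  leaf-≢-branching leaf a≢x b≢x ¬ab refl = ¬ab (leaf-sameBranch leaf a≢x b≢x)

  ¬sameBranch⇒toward≢ : ∀ {x e e′ a b} → Toward x e a → Toward x e′ b → ¬ SameBranch x a b → e ≢ e′
  ¬sameBranch⇒toward≢ fa fb ¬ab refl = ¬ab (_ , fa , fb)

  three-branches⇒node : ∀ {x a b c} → a ≢ x → b ≢ x → c ≢ x →
                        ¬ SameBranch x a b → ¬ SameBranch x a c → ¬ SameBranch x b c → IsNode t x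
  three-branches⇒node a≢x b≢x c≢x ¬ab ¬ac ¬bc with toward-exists a≢x | toward-exists b≢x | toward-exists c≢x
  ... | _ , fa | _ , fb | _ , fc =
    3≤countFin _ (¬sameBranch⇒toward≢ fa fb ¬ab) (¬sameBranch⇒toward≢ fa fc ¬ac) (¬sameBranch⇒toward≢ fb fc ¬bc)
      (⇒degreeEdge (toward-incident fa)) (⇒degreeEdge (toward-incident fb)) (⇒degreeEdge (toward-incident fc))

  degIn≤degree : ∀ S x → degIn t (inSub t S) x ≤ degree t x
  degIn≤degree S x = countFin-mono _ _ (λ e h → ⇒degreeEdge (incident⇒ {x} {e} (proj₂ (to (T-∧ {inSub t S e}) h))))

  unique-incident⇒leaf : ∀ {z e} → Incident z e → (∀ e′ → Incident z e′ → e′ ≡ e) → IsLeaf t z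
  unique-incident⇒leaf i only = countFin-singleton _ _ (⇒degreeEdge i) (λ e′ h → only e′ (degreeEdge⇒ {e = e′} h))

  leaf-below : ∀ {h} → h ≢ root → ∃[ z ] (IsLeaf t z × Below z h)
  leaf-below {h} h≢root with argmax-nonempty (λ v → below t v h) depth (below-complete (Below-refl h))
  ... | z , zh , deepest = z , unique-incident⇒leaf (z≢root , inj₁ refl) only , below-sound zh
    where
    z≢root : z ≢ root
    z≢root refl = h≢root (Below-root⇒root (below-sound zh))
    only : ∀ e → Incident z e → e ≡ z
    only e (_ , inj₁ e≡z) = e≡z
    only e (e≢root , inj₂ pe≡z) with e ≟ z
    ... | yes e≡z = e≡z
    ... | no _ = ⊥-elim (<-irrefl refl (<-≤-trans (child-deeper e≢root pe≡z)
                   (deepest e (below-complete (Below-trans (subst (Below e) pe≡z (Below-parent e)) (below-sound zh))))))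

  incident-to-deepest-outside : ∀ {q z} → ¬ Below z q → (∀ y → ¬ Below y q → depth y ≤ depth z) →
                                ∀ e → Incident z e → e ≡ z ⊎ e ≡ q
  incident-to-deepest-outside ¬zq deepest e (_ , inj₁ e≡z) = inj₁ e≡z
  incident-to-deepest-outside {q} {z} ¬zq deepest e (e≢root , inj₂ pe≡z) with e ≟ z | Below? e q
  ... | yes e≡z | _ = inj₁ e≡z
  ... | no _ | no ¬eq = ⊥-elim (<-irrefl refl (<-≤-trans (child-deeper e≢root pe≡z) (deepest e ¬eq)))
  ... | no _ | yes eq with e ≟ q
  ...   | yes e≡q = inj₂ e≡q
  ...   | no e≢q = ⊥-elim (¬zq (subst (λ v → Below v q) pe≡z (Below-up eq e≢q)))

  -- The deepest vertex outside the subtree of q has no child other than q, so it is a leaf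
  -- unless it has exactly the two neighbours q and its parent, which essentiality excludes.
  leaf-outside : Essential t → ∀ {q} → q ≢ root → ∃[ z ] (IsLeaf t z × ¬ Below z q)
  leaf-outside ess {q} q≢root
    with argmax-nonempty (λ v → not (below t v q)) depth (from T-not-≡ (below≡false (λ b → q≢root (Below-root⇒root b))))
  ... | z , zq , deepest = z , z-leaf , ¬zq
    where
    ¬zq : ¬ Below z q
    ¬zq = below≡false⁻¹ (to T-not-≡ zq)
    edges : ∀ e → Incident z e → e ≡ z ⊎ e ≡ q
    edges = incident-to-deepest-outside ¬zq (λ y ¬yq → deepest y (from T-not-≡ (below≡false ¬yq)))
    q-child : ∀ {e} → Incident z e → e ≡ q → parent q ≡ z
    q-child (_ , inj₁ refl) refl = ⊥-elim (¬zq (Below-refl _))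
    q-child (_ , inj₂ pq≡z) refl = pq≡z
    z-leaf : IsLeaf t z
    z-leaf with z ≟ root | parent q ≟ z
    ... | yes refl | _ with Below-root q
    ...   | zero , q≡root = ⊥-elim (q≢root q≡root)
    ...   | suc k , reach with child-toward k q reach (λ q≡root → q≢root q≡root)
    ...     | c , c≢root , pc≡root , _ = unique-incident⇒leaf c-edge λ e i → [ (λ { refl → ⊥-elim (proj₁ i refl) }) , id ]′ (edges e i)
      where
      c-edge : Incident z q
      c-edge with edges c (c≢root , inj₂ pc≡root)
      ... | inj₁ c≡root = ⊥-elim (c≢root c≡root)
      ... | inj₂ refl = c≢root , inj₂ pc≡root
    z-leaf | no z≢root | yes pq≡z =
      ⊥-elim (ess z (countFin-pair _ z q (λ { refl → ¬zq (Below-refl q) }) (⇒degreeEdge (z≢root , inj₁ refl))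
                      (⇒degreeEdge (q≢root , inj₂ pq≡z)) (λ e h → edges e (degreeEdge⇒ {e = e} h))))
    z-leaf | no z≢root | no pq≢z =
      unique-incident⇒leaf (z≢root , inj₁ refl) λ e i → [ id , (λ e≡q → ⊥-elim (pq≢z (q-child i e≡q))) ]′ (edges e i)

  leaf-toward : Essential t → ∀ {q h} → Incident q h → ∃[ r ] (IsLeaf t r × Toward q h r)
  leaf-toward ess {q} (q≢root , inj₁ refl) with leaf-outside ess q≢root
  ... | z , z-leaf , ¬zq = z , z-leaf , inj₁ (refl , q≢root , ¬zq)
  leaf-toward ess {q} {h} (h≢root , inj₂ ph≡q) with h ≟ q
  ... | yes refl = leaf-toward ess (h≢root , inj₁ refl)
  ... | no h≢q with leaf-below h≢root
  ... | z , z-leaf , zh = z , z-leaf , inj₂ (h≢q , ph≡q , zh)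

  essential-third-edge : Essential t → ∀ {q e₁ e₂} → Incident q e₁ → Incident q e₂ → e₁ ≢ e₂ →
                         IsNode t q × ∃[ e₃ ] (Incident q e₃ × e₃ ≢ e₁ × e₃ ≢ e₂)
  essential-third-edge ess {q} {e₁} {e₂} i₁ i₂ e₁≢e₂ = node , third
    where
    node : IsNode t q
    node with m≤n⇒m<n∨m≡n (degree-≥2 i₁ i₂ e₁≢e₂)
    ... | inj₁ 2<deg = 2<deg
    ... | inj₂ 2≡deg = ⊥-elim (ess q (sym 2≡deg))
    third : ∃[ e₃ ] (Incident q e₃ × e₃ ≢ e₁ × e₃ ≢ e₂)
    third with countFin-witness₃ _ node
    ... | a , b , c , (a≢b , a≢c , b≢c) , ha , hb , hc with a ≟ e₁ | a ≟ e₂ | b ≟ e₁ | b ≟ e₂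
    ... | no a≢e₁ | no a≢e₂ | _ | _ = a , degreeEdge⇒ {e = a} ha , a≢e₁ , a≢e₂
    ... | _ | _ | no b≢e₁ | no b≢e₂ = b , degreeEdge⇒ {e = b} hb , b≢e₁ , b≢e₂
    ... | yes refl | _ | _ | yes refl = c , degreeEdge⇒ {e = c} hc , (λ e → a≢c (sym e)) , (λ e → b≢c (sym e))
    ... | _ | yes refl | yes refl | _ = c , degreeEdge⇒ {e = c} hc , (λ e → b≢c (sym e)) , (λ e → a≢c (sym e))
    ... | yes refl | _ | yes refl | _ = ⊥-elim (a≢b refl)
    ... | _ | yes refl | _ | yes refl = ⊥-elim (a≢b refl)

  edge-between-nodes-internal : ∀ {x g q} → Adjacent x g q → IsNode t x → IsNode t q → Internal t g
  edge-between-nodes-internal {x} {g} {q} adj x-node q-node = ⇒isEdge g≢root , ¬twig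
    where
    g≢root : g ≢ root
    g≢root = toward-edge (adjacent-toward adj)
    endpoints-nodes : Adjacent x g q → IsNode t g × IsNode t (parent g)
    endpoints-nodes (inj₁ (refl , refl , _)) = x-node , q-node
    endpoints-nodes (inj₂ (_ , pg≡x , refl)) = q-node , subst (IsNode t) (sym pg≡x) x-node
    ¬twig : ¬ OnTwig t g
    ¬twig (F , Nd , _ , _ , no-inner-node , onPath) with g ≟ Nd
    ... | yes refl = no-inner-node (parent g) (inj₂ (inj₂ (g , from T-∧ (onPath , ⇒incident (g≢root , inj₂ refl)))))
                       (parent-≢ g≢root) (proj₂ (endpoints-nodes adj))
    ... | no g≢Nd = no-inner-node g (inj₂ (inj₂ (g , from T-∧ (onPath , ⇒incident (g≢root , inj₁ refl))))) g≢Nd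
                      (proj₁ (endpoints-nodes adj))

module Subtrees {N : ℕ} (t : Tree N) where
  open Tree t
  open Ancestry t
  open Branches t
  open Sides t
  open Degrees t

  NodeOf : List (Fin N) → Fin N → Set
  NodeOf S x = ∃[ a ] ∃[ b ] ∃[ c ] ((a ∈ S × b ∈ S × c ∈ S) × (a ≢ x × b ≢ x × c ≢ x) ×
                 (¬ SameBranch x a b × ¬ SameBranch x a c × ¬ SameBranch x b c))

  inSub-sides : ∀ {S e a b} → T (isEdge t e) → a ∈ S → b ∈ S → below t a e ≡ true → below t b e ≡ false → T (inSub t S e)
  inSub-sides isE aS bS a-in b-out =
    from T-∧ (isE , from T-∧ (any⁺ _ (lose aS (T-true a-in)) , any⁺ _ (lose bS (from T-not-≡ b-out))))

  subEdge⇒toward : ∀ {S x e} → T (inSub t S e ∧ incident t x e) → ∃[ s ] (s ∈ S × Toward x e s)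
  subEdge⇒toward {S} {x} {e} h with to (T-∧ {inSub t S e}) h
  ... | sub , inc with to T-∧ (proj₂ (to (T-∧ {isEdge t e}) sub))
  ... | some-in , some-out with find (any⁻ _ S some-in) | find (any⁻ _ S some-out) | below t x e in x-side
  ... | a , aS , a-in | _ , _ , _ | false = a , aS , below≢⇒toward (incident⇒ inc) (λ eq → ¬T-false (trans eq x-side) a-in)
  ... | _ , _ , _ | b , bS , b-out | true =
    b , bS , below≢⇒toward (incident⇒ inc) (λ eq → ¬T-false (to T-not-≡ b-out) (T-true (trans eq x-side)))

  toward⇒subEdge : ∀ {S x e a b} → Toward x e a → a ∈ S → b ∈ S → ¬ SameBranch x a b → T (inSub t S e ∧ incident t x e)
  toward⇒subEdge {S} {x} {e} {a} {b} fa aS bS ¬ab =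
    from T-∧ (sub (Bool-≢-cases a≢b) , ⇒incident (toward-incident fa))
    where
    a≢b : below t a e ≢ below t b e
    a≢b = toward-¬toward-below≢ fa (λ fb → ¬ab (e , fa , fb))
    sub : (below t a e ≡ true × below t b e ≡ false) ⊎ (below t a e ≡ false × below t b e ≡ true) → T (inSub t S e)
    sub (inj₁ (a-in , b-out)) = inSub-sides (⇒isEdge (toward-edge fa)) aS bS a-in b-out
    sub (inj₂ (a-out , b-in)) = inSub-sides (⇒isEdge (toward-edge fa)) bS aS b-in a-out

  node-of-subtree⇒NodeOf : ∀ {S x} → 2 < degIn t (inSub t S) x → NodeOf S x
  node-of-subtree⇒NodeOf {S} {x} h with countFin-witness₃ _ h
  ... | e₁ , e₂ , e₃ , (e₁≢e₂ , e₁≢e₃ , e₂≢e₃) , h₁ , h₂ , h₃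
    with subEdge⇒toward {S} h₁ | subEdge⇒toward {S} h₂ | subEdge⇒toward {S} h₃
  ... | a , aS , fa | b , bS , fb | c , cS , fc =
    a , b , c , (aS , bS , cS) , (toward-≢ fa , toward-≢ fb , toward-≢ fc) ,
    (different e₁≢e₂ fa fb , different e₁≢e₃ fa fc , different e₂≢e₃ fb fc)
    where
    different : ∀ {e e′ u v} → e ≢ e′ → Toward x e u → Toward x e′ v → ¬ SameBranch x u v
    different e≢e′ fu fv (d , gu , gv) = e≢e′ (trans (toward-unique fu gu) (toward-unique gv fv))

  NodeOf⇒node-of-subtree : ∀ {S x} → NodeOf S x → 2 < degIn t (inSub t S) x
  NodeOf⇒node-of-subtree {S} {x} (a , b , c , (aS , bS , cS) , (a≢x , b≢x , c≢x) , (¬ab , ¬ac , ¬bc))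
    with toward-exists a≢x | toward-exists b≢x | toward-exists c≢x
  ... | _ , fa | _ , fb | _ , fc =
    3≤countFin _ (¬sameBranch⇒toward≢ fa fb ¬ab) (¬sameBranch⇒toward≢ fa fc ¬ac) (¬sameBranch⇒toward≢ fb fc ¬bc)
      (toward⇒subEdge fa aS bS ¬ab) (toward⇒subEdge fb bS aS (λ s → ¬ab (sameBranch-sym s)))
      (toward⇒subEdge fc cS aS (λ s → ¬ac (sameBranch-sym s)))

  Between : Fin N → Fin N → Fin N → Set
  Between a b x = a ≢ x × b ≢ x × ¬ SameBranch x a b

  separating-edge⇒¬sameBranch : ∀ {x e a b} → Incident x e → below t a e ≢ below t b e → ¬ SameBranch x a b
  separating-edge⇒¬sameBranch {x} {e} {a} {b} inc a≢b (d , fa , fb) = a≢b (toward-below≡ (at-e fa) (at-e fb))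
    where
    e≡d : e ≡ d
    e≡d with below t a e Bool.≟ below t x e
    ... | no a≢x = toward-unique (below≢⇒toward inc a≢x) fa
    ... | yes a≡x = toward-unique (below≢⇒toward inc (λ b≡x → a≢b (trans a≡x (sym b≡x)))) fb
    at-e : ∀ {u} → Toward x d u → Toward x e u
    at-e = subst (λ d → Toward x d _) (sym e≡d)

  onPath⇒between : ∀ {a b x} → OnPathV t a b x → x ≢ a → x ≢ b → Between a b x
  onPath⇒between (inj₁ x≡a) x≢a _ = ⊥-elim (x≢a x≡a)
  onPath⇒between (inj₂ (inj₁ x≡b)) _ x≢b = ⊥-elim (x≢b x≡b)
  onPath⇒between {a} {b} {x} (inj₂ (inj₂ (e , h))) x≢a x≢b =
    (λ a≡x → x≢a (sym a≡x)) , (λ b≡x → x≢b (sym b≡x)) ,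
    separating-edge⇒¬sameBranch (incident⇒ inc) (to T-xor (proj₂ (to (T-∧ {isEdge t e}) onPath)))
    where
    onPath = proj₁ (to (T-∧ {onPathE t a b e}) h)
    inc = proj₂ (to (T-∧ {onPathE t a b e}) h)

  between⇒onPath : ∀ {a b x} → Between a b x → OnPathV t a b x
  between⇒onPath {a} {b} {x} (a≢x , _ , ¬ab) with toward-exists a≢x
  ... | e , fa = inj₂ (inj₂ (e , from T-∧ (from T-∧ (⇒isEdge (toward-edge fa) , from T-xor a≢b) , ⇒incident (toward-incident fa))))
    where
    a≢b : below t a e ≢ below t b e
    a≢b = toward-¬toward-below≢ fa (λ fb → ¬ab (e , fa , fb))

module Medians {N : ℕ} (t : Tree N) where
  open Tree t
  open Ancestry t
  open Branches t
  open Degrees t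

  lca-¬sameBranch : ∀ {a b z} → Below a z → Below b z → (∀ y → Below a y → Below b y → depth y ≤ depth z) →
                    ¬ SameBranch z a b
  lca-¬sameBranch az _ _ (_ , inj₁ (refl , _ , ¬az) , _) = ¬az az
  lca-¬sameBranch _ _ _ (_ , inj₂ (d≢z , _) , inj₁ (d≡z , _)) = d≢z d≡z
  lca-¬sameBranch _ _ deepest (d , inj₂ (d≢z , pd≡z , ad) , inj₂ (_ , _ , bd)) =
    <-irrefl refl (<-≤-trans (child-deeper (toward-edge (inj₂ (d≢z , pd≡z , ad))) pd≡z) (deepest d ad bd))

  below-outside-¬sameBranch : ∀ {u v x} → Below u x → u ≢ x → ¬ Below v x → ¬ SameBranch x u v
  below-outside-¬sameBranch _ _ ¬vx (d , _ , inj₂ (_ , pd≡x , vd)) = ¬vx (Below-trans vd (subst (Below d) pd≡x (Below-parent d)))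
  below-outside-¬sameBranch ux _ _ (_ , inj₁ (_ , _ , ¬ux) , inj₁ (refl , _)) = ¬ux ux
  below-outside-¬sameBranch _ _ _ (_ , inj₂ (d≢x , _) , inj₁ (refl , _)) = d≢x refl

  leaf-no-descendant : ∀ {u v} → IsLeaf t v → v ≢ root → Below u v → u ≢ v → ⊥
  leaf-no-descendant {u} {v} v-leaf v≢root uv u≢v with toward-exists u≢v
  ... | _ , inj₁ (refl , _ , ¬uv) = ¬uv uv
  ... | c , inj₂ (c≢v , pc≡v , uc) =
    c≢v (leaf-incident-unique v-leaf (toward-edge (inj₂ (c≢v , pc≡v , uc)) , inj₂ pc≡v) (v≢root , inj₁ refl))

  IsMedian : Fin N → Fin N → Fin N → Fin N → Set
  IsMedian x a b c = (a ≢ x × b ≢ x × c ≢ x) × ¬ SameBranch x a b × ¬ SameBranch x a c × ¬ SameBranch x b c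

  Median : Fin N → Fin N → Fin N → Set
  Median a b c = ∃[ x ] IsMedian x a b c

  median-swap₁₂ : ∀ {a b c} → Median a b c → Median b a c
  median-swap₁₂ (x , (a≢x , b≢x , c≢x) , ¬ab , ¬ac , ¬bc) = x , (b≢x , a≢x , c≢x) , ¬sameBranch-sym ¬ab , ¬bc , ¬ac

  median-swap₂₃ : ∀ {a b c} → Median a b c → Median a c b
  median-swap₂₃ (x , (a≢x , b≢x , c≢x) , ¬ab , ¬ac , ¬bc) = x , (a≢x , c≢x , b≢x) , ¬ac , ¬ab , ¬sameBranch-sym ¬bc

  median-at-root : ∀ {a b c} → a ≡ root → IsLeaf t a → IsLeaf t b → IsLeaf t c → b ≢ root → c ≢ root → b ≢ c → Median a b c
  median-at-root {a} {b} {c} refl a-leaf b-leaf c-leaf b≢root c≢root b≢c with lowest-common-ancestor b c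
  ... | z , bz , cz , deepest =
    z , (root≢z , b≢z , c≢z) , root-apart bz b≢z , root-apart cz c≢z , lca-¬sameBranch bz cz deepest
    where
    b≢z : b ≢ z
    b≢z refl = leaf-no-descendant b-leaf b≢root cz (λ c≡b → b≢c (sym c≡b))
    c≢z : c ≢ z
    c≢z refl = leaf-no-descendant c-leaf c≢root bz b≢c
    z≢root : z ≢ root
    z≢root refl = lca-¬sameBranch bz cz deepest (leaf-sameBranch a-leaf b≢root c≢root)
    root≢z : root ≢ z
    root≢z root≡z = z≢root (sym root≡z)
    root-apart : ∀ {u} → Below u z → u ≢ z → ¬ SameBranch z root u
    root-apart uz u≢z ru = below-outside-¬sameBranch uz u≢z (λ rz → z≢root (Below-root⇒root rz)) (sameBranch-sym ru)

  median-case : ∀ {a b c z} → IsLeaf t a → IsLeaf t b → IsLeaf t c → a ≢ root → c ≢ root → a ≢ c →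
                Below a z → ¬ SameBranch z a b → SameBranch z c a → Median a b c
  median-case _ _ _ _ _ _ az _ (_ , _ , inj₁ (_ , _ , ¬az)) = ⊥-elim (¬az az)
  median-case _ _ _ _ _ _ _ _ (_ , inj₁ (d≡z , _) , inj₂ (d≢z , _)) = ⊥-elim (d≢z d≡z)
  median-case {a} {b} {c} a-leaf b-leaf c-leaf a≢root c≢root a≢c _ ¬ab (d , inj₂ (_ , _ , cd) , inj₂ (d≢z , pd≡z , ad))
    with lowest-common-ancestor a c
  ... | y , ay , cy , deepest =
    y , (a≢y , b≢y , c≢y) , below-outside-¬sameBranch ay a≢y ¬by , lca-¬sameBranch ay cy deepest ,
    ¬sameBranch-sym (below-outside-¬sameBranch cy c≢y ¬by)
    where
    a≢y : a ≢ y
    a≢y refl = leaf-no-descendant a-leaf a≢root cy (λ c≡a → a≢c (sym c≡a))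
    c≢y : c ≢ y
    c≢y refl = leaf-no-descendant c-leaf c≢root ay a≢c
    b≢y : b ≢ y
    b≢y refl = lca-¬sameBranch ay cy deepest (leaf-sameBranch b-leaf a≢y c≢y)
    y-below-d : Below y d
    y-below-d with Below-comparable ad ay
    ... | inj₂ yd = yd
    ... | inj₁ dy with d ≟ y
    ...   | yes refl = Below-refl d
    ...   | no d≢y = ⊥-elim (<-irrefl refl (<-≤-trans (Below-depth dy d≢y) (deepest d ad cd)))
    ¬by : ¬ Below b y
    ¬by by = ¬ab (d , inj₂ (d≢z , pd≡z , ad) , inj₂ (d≢z , pd≡z , Below-trans by y-below-d))

  median : ∀ {a b c} → IsLeaf t a → IsLeaf t b → IsLeaf t c → a ≢ b → a ≢ c → b ≢ c → Median a b c
  median {a} {b} {c} a-leaf b-leaf c-leaf a≢b a≢c b≢c with a ≟ root | b ≟ root | c ≟ root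
  ... | yes a≡root | _ | _ =
    median-at-root a≡root a-leaf b-leaf c-leaf (λ b≡root → a≢b (trans a≡root (sym b≡root))) (λ c≡root → a≢c (trans a≡root (sym c≡root))) b≢c
  ... | no a≢root | yes b≡root | _ =
    median-swap₁₂ (median-at-root b≡root b-leaf a-leaf c-leaf a≢root (λ c≡root → b≢c (trans b≡root (sym c≡root))) a≢c)
  ... | no a≢root | no b≢root | yes c≡root = median-swap₂₃ (median-swap₁₂ (median-at-root c≡root c-leaf a-leaf b-leaf a≢root b≢root a≢b))
  ... | no a≢root | no b≢root | no c≢root with lowest-common-ancestor a b
  ... | z , az , bz , deepest = by-branch-of-c (sameBranch? c≢z a≢z) (sameBranch? c≢z b≢z)
    where
    a≢z : a ≢ z
    a≢z refl = leaf-no-descendant a-leaf a≢root bz (λ b≡a → a≢b (sym b≡a))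
    b≢z : b ≢ z
    b≢z refl = leaf-no-descendant b-leaf b≢root az a≢b
    ¬ab : ¬ SameBranch z a b
    ¬ab = lca-¬sameBranch az bz deepest
    c≢z : c ≢ z
    c≢z refl = ¬ab (leaf-sameBranch c-leaf a≢z b≢z)
    by-branch-of-c : Dec (SameBranch z c a) → Dec (SameBranch z c b) → Median a b c
    by-branch-of-c (yes ca) _ = median-case a-leaf b-leaf c-leaf a≢root c≢root a≢c az ¬ab ca
    by-branch-of-c (no _) (yes cb) = median-swap₁₂ (median-case b-leaf a-leaf c-leaf b≢root c≢root b≢c bz (¬sameBranch-sym ¬ab) cb)
    by-branch-of-c (no ¬ca) (no ¬cb) = z , (a≢z , b≢z , c≢z) , ¬ab , ¬sameBranch-sym ¬ca , ¬sameBranch-sym ¬cb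

Split4 : Bool → Bool → Bool → Bool → Set
Split4 p q u v = p ≡ q × u ≡ v × p ≢ u

split4-swapˡ : ∀ {p q u v} → Split4 p q u v → Split4 q p u v
split4-swapˡ (refl , refl , p≢u) = refl , refl , p≢u

split4-swapʳ : ∀ {p q u v} → Split4 p q u v → Split4 p q v u
split4-swapʳ (refl , refl , p≢u) = refl , refl , p≢u

split4-sym : ∀ {p q u v} → Split4 p q u v → Split4 u v p q
split4-sym (refl , refl , p≢u) = refl , refl , λ e → p≢u (sym e)

split4-normal : ∀ {p q u v} → Split4 p q u v → q ≡ p × u ≡ not p × v ≡ not p
split4-normal {true} {_} {false} (refl , refl , _) = refl , refl , refl
split4-normal {false} {_} {true} (refl , refl , _) = refl , refl , refl
split4-normal {true} {_} {true} (_ , _ , p≢u) = ⊥-elim (p≢u refl)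
split4-normal {false} {_} {false} (_ , _ , p≢u) = ⊥-elim (p≢u refl)

split4-extend : ∀ {p q u v} → Split4 p q u v → ∀ x → Split4 p q x u ⊎ Split4 x p v u
split4-extend {p} (refl , refl , p≢u) x with x Bool.≟ p
... | yes refl = inj₂ (refl , refl , p≢u)
... | no x≢p = inj₁ (refl , ≢-≢⇒≡ x≢p (λ e → p≢u (sym e)) , λ e → x≢p (sym e))

module EdgeSplits {N : ℕ} (t : Tree N) where
  open Tree t
  open Ancestry t
  open Branches t
  open Sides t

  SplitsAt : Fin N → Fin N → Fin N → Fin N → Fin N → Set
  SplitsAt e a b c d = e ≢ root × Split4 (below t a e) (below t b e) (below t c e) (below t d e)

  splitsAt-swapˡ : ∀ {e a b c d} → SplitsAt e a b c d → SplitsAt e b a c d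
  splitsAt-swapˡ (e≢root , s) = e≢root , split4-swapˡ s

  splitsAt-swapʳ : ∀ {e a b c d} → SplitsAt e a b c d → SplitsAt e a b d c
  splitsAt-swapʳ (e≢root , s) = e≢root , split4-swapʳ s

  splitsAt-sym : ∀ {e a b c d} → SplitsAt e a b c d → SplitsAt e c d a b
  splitsAt-sym (e≢root , s) = e≢root , split4-sym s

  splitsAt-extend : ∀ {e a b c d} → SplitsAt e a b c d → ∀ x → SplitsAt e a b x c ⊎ SplitsAt e x a d c
  splitsAt-extend (e≢root , s) x with split4-extend s (below t x _)
  ... | inj₁ s′ = inj₁ (e≢root , s′)
  ... | inj₂ s′ = inj₂ (e≢root , s′)

  subtrees-¬cross : ∀ {e f p₁ p₂ p₃} → Below p₁ e → Below p₁ f → Below p₂ e → ¬ Below p₂ f → ¬ Below p₃ e → Below p₃ f → ⊥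
  subtrees-¬cross {e} {f} {p₁} {p₂} {p₃} p₁e p₁f p₂e ¬p₂f ¬p₃e p₃f with subtrees-nested-or-disjoint e f
  ... | inj₁ e⊆f = ¬p₂f (e⊆f p₂ p₂e)
  ... | inj₂ (inj₁ f⊆e) = ¬p₃e (f⊆e p₃ p₃f)
  ... | inj₂ (inj₂ disjoint) = disjoint p₁ p₁e p₁f

  splits-incompatible : ∀ {e f p₁ p₂ p₃ p₄} → SplitsAt e p₁ p₂ p₃ p₄ → SplitsAt f p₁ p₃ p₂ p₄ → ⊥
  splits-incompatible {e} {f} {p₁} {p₂} {p₃} {p₄} (_ , se) (_ , sf) with split4-normal se | split4-normal sf
  ... | p₂e , p₃e , p₄e | p₃f , p₂f , p₄f = cases (below t p₁ e) refl (below t p₁ f) refl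
    where
    cases : ∀ α → below t p₁ e ≡ α → ∀ β → below t p₁ f ≡ β → ⊥
    cases true p₁e true p₁f =
      subtrees-¬cross (below≡true⁻¹ p₁e) (below≡true⁻¹ p₁f) (below≡true⁻¹ (trans p₂e p₁e))
        (below≡false⁻¹ (trans p₂f (cong not p₁f))) (below≡false⁻¹ (trans p₃e (cong not p₁e))) (below≡true⁻¹ (trans p₃f p₁f))
    cases true p₁e false p₁f =
      subtrees-¬cross (below≡true⁻¹ (trans p₂e p₁e)) (below≡true⁻¹ (trans p₂f (cong not p₁f))) (below≡true⁻¹ p₁e)
        (below≡false⁻¹ p₁f) (below≡false⁻¹ (trans p₄e (cong not p₁e))) (below≡true⁻¹ (trans p₄f (cong not p₁f)))
    cases false p₁e true p₁f =
      subtrees-¬cross (below≡true⁻¹ (trans p₃e (cong not p₁e))) (below≡true⁻¹ (trans p₃f p₁f))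
        (below≡true⁻¹ (trans p₄e (cong not p₁e))) (below≡false⁻¹ (trans p₄f (cong not p₁f))) (below≡false⁻¹ p₁e) (below≡true⁻¹ p₁f)
    cases false p₁e false p₁f =
      subtrees-¬cross (below≡true⁻¹ (trans p₄e (cong not p₁e))) (below≡true⁻¹ (trans p₄f (cong not p₁f)))
        (below≡true⁻¹ (trans p₃e (cong not p₁e))) (below≡false⁻¹ (trans p₃f p₁f))
        (below≡false⁻¹ (trans p₂e p₁e)) (below≡true⁻¹ (trans p₂f (cong not p₁f)))

  split-side : ∀ {e a b c d} → SplitsAt e a b c d → ∀ y →
               (below t y e ≡ below t a e × SameBranch y c d) ⊎ (below t y e ≡ below t c e × SameBranch y a b)
  split-side {e} {a} {b} {c} {d} (e≢root , a≡b , c≡d , a≢c) y with below t y e Bool.≟ below t a e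
  ... | yes y≡a = inj₁ (y≡a , across-edgeᵇ⇒sameBranch e≢root c≡d (λ y≡c → a≢c (trans (sym y≡a) y≡c)))
  ... | no y≢a = inj₂ (≢-≢⇒≡ y≢a (λ c≡a → a≢c (sym c≡a)) , across-edgeᵇ⇒sameBranch e≢root a≡b y≢a)

  ¬split-at : ∀ {e a b c d} y → ¬ SameBranch y a b → ¬ SameBranch y c d → ¬ SplitsAt e a b c d
  ¬split-at y ¬ab ¬cd split with split-side split y
  ... | inj₁ (_ , cd) = ¬cd cd
  ... | inj₂ (_ , ab) = ¬ab ab

module NeighbourNodes {N : ℕ} (t : Tree N) (S : List (Fin N)) (S-leaves : ∀ {u} → u ∈ S → IsLeaf t u) where
  open Tree t
  open Ancestry t
  open Branches t
  open Degrees t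
  open Subtrees t

  leaf-¬subtree-node : ∀ {a} → IsLeaf t a → ¬ 2 < degIn t (inSub t S) a
  leaf-¬subtree-node {a} leaf node with <-≤-trans node (subst (degIn t (inSub t S) a ≤_) leaf (degIn≤degree S a))
  ... | s≤s ()

  path-node⇒ : ∀ {a b x} → IsLeaf t a → IsLeaf t b → OnPathV t a b x → 2 < degIn t (inSub t S) x →
               Between a b x × NodeOf S x
  path-node⇒ a-leaf b-leaf onPath node =
    onPath⇒between onPath (λ { refl → leaf-¬subtree-node a-leaf node }) (λ { refl → leaf-¬subtree-node b-leaf node }) ,
    node-of-subtree⇒NodeOf node

  ⇒path-node : ∀ {a b x} → Between a b x → NodeOf S x → OnPathV t a b x × 2 < degIn t (inSub t S) x
  ⇒path-node between node = between⇒onPath between , NodeOf⇒node-of-subtree node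

  two-toward-other-node : ∀ {x y} → x ≢ y → (∀ {u} → u ∈ S → u ≢ x) → NodeOf S y →
                          ∃[ u ] ∃[ v ] (u ∈ S × v ∈ S × u ≢ v × SameBranch x u y × SameBranch x v y)
  two-toward-other-node {x} {y} x≢y S≢x (a , b , c , (aS , bS , cS) , (a≢y , b≢y , c≢y) , (¬ab , ¬ac , ¬bc))
    with sameBranch? a≢y x≢y | sameBranch? b≢y x≢y
  ... | yes ax | _ =
    b , c , bS , cS , ¬sameBranch⇒≢ b≢y ¬bc ,
    sameBranch-flip x≢y (S≢x bS) b≢y (λ bx → ¬ab (sameBranch-trans ax (sameBranch-sym bx))) ,
    sameBranch-flip x≢y (S≢x cS) c≢y (λ cx → ¬ac (sameBranch-trans ax (sameBranch-sym cx)))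
  ... | no ¬ax | yes bx =
    a , c , aS , cS , ¬sameBranch⇒≢ a≢y ¬ac , sameBranch-flip x≢y (S≢x aS) a≢y ¬ax ,
    sameBranch-flip x≢y (S≢x cS) c≢y (λ cx → ¬bc (sameBranch-trans bx (sameBranch-sym cx)))
  ... | no ¬ax | no ¬bx =
    a , b , aS , bS , ¬sameBranch⇒≢ a≢y ¬ab , sameBranch-flip x≢y (S≢x aS) a≢y ¬ax , sameBranch-flip x≢y (S≢x bS) b≢y ¬bx

  record NeighbourNode (x a b c d : Fin N) : Set where
    field
      S⊆abcd : ∀ {u} → u ∈ S → u ≡ a ⊎ u ≡ b ⊎ u ≡ c ⊎ u ≡ d
      S≢x : ∀ {u} → u ∈ S → u ≢ x
      a∈S : a ∈ S
      b∈S : b ∈ S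
      c∈S : c ∈ S
      ¬ab : ¬ SameBranch x a b
      ¬ac : ¬ SameBranch x a c
      ¬bc : ¬ SameBranch x b c
      cd : SameBranch x c d

  module _ {x a b c d : Fin N} (nn : NeighbourNode x a b c d) where
    open NeighbourNode nn

    sameBranch⇒branch-of-c : ∀ {u v} → u ∈ S → v ∈ S → u ≢ v → SameBranch x u v → SameBranch x u c
    sameBranch⇒branch-of-c uS vS u≢v uv with S⊆abcd uS | S⊆abcd vS
    ... | inj₁ refl | inj₁ refl = ⊥-elim (u≢v refl)
    ... | inj₁ refl | inj₂ (inj₁ refl) = ⊥-elim (¬ab uv)
    ... | inj₁ refl | inj₂ (inj₂ (inj₁ refl)) = ⊥-elim (¬ac uv)
    ... | inj₁ refl | inj₂ (inj₂ (inj₂ refl)) = ⊥-elim (¬ac (sameBranch-trans uv (sameBranch-sym cd)))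
    ... | inj₂ (inj₁ refl) | inj₁ refl = ⊥-elim (¬ab (sameBranch-sym uv))
    ... | inj₂ (inj₁ refl) | inj₂ (inj₁ refl) = ⊥-elim (u≢v refl)
    ... | inj₂ (inj₁ refl) | inj₂ (inj₂ (inj₁ refl)) = ⊥-elim (¬bc uv)
    ... | inj₂ (inj₁ refl) | inj₂ (inj₂ (inj₂ refl)) = ⊥-elim (¬bc (sameBranch-trans uv (sameBranch-sym cd)))
    ... | inj₂ (inj₂ (inj₁ refl)) | _ = sameBranch-refl (S≢x c∈S)
    ... | inj₂ (inj₂ (inj₂ refl)) | _ = sameBranch-sym cd

    other-node⇒branch-of-c : ∀ {y} → x ≢ y → NodeOf S y → SameBranch x c y
    other-node⇒branch-of-c x≢y y-node with two-toward-other-node x≢y S≢x y-node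
    ... | u , v , uS , vS , u≢v , uy , vy =
      sameBranch-trans (sameBranch-sym (sameBranch⇒branch-of-c uS vS u≢v (sameBranch-trans uy (sameBranch-sym vy)))) uy

    unique-node-between : ∀ {y} → Between a b y → NodeOf S y → y ≡ x
    unique-node-between {y} (a≢y , b≢y , ¬ab-at-y) y-node with x ≟ y
    ... | yes x≡y = sym x≡y
    ... | no x≢y with sameBranch? a≢y x≢y | sameBranch? b≢y x≢y
    ...   | yes ax | yes bx = ⊥-elim (¬ab-at-y (sameBranch-trans ax (sameBranch-sym bx)))
    ...   | no ¬ax | _ = ⊥-elim (¬ac (sameBranch-trans (sameBranch-flip x≢y (S≢x a∈S) a≢y ¬ax)
                                        (sameBranch-sym (other-node⇒branch-of-c x≢y y-node))))
    ...   | _ | no ¬bx = ⊥-elim (¬bc (sameBranch-trans (sameBranch-flip x≢y (S≢x b∈S) b≢y ¬bx)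
                                        (sameBranch-sym (other-node⇒branch-of-c x≢y y-node))))

    neighbourNode-NodeOf : NodeOf S x
    neighbourNode-NodeOf = a , b , c , (a∈S , b∈S , c∈S) , (S≢x a∈S , S≢x b∈S , S≢x c∈S) , (¬ab , ¬ac , ¬bc)

    neighbourNode⇒neighbours : NeighboursIn t S a b
    neighbourNode⇒neighbours =
      x , ⇒path-node (S≢x a∈S , S≢x b∈S , ¬ab) neighbourNode-NodeOf ,
      λ y onPath node → let (between , y-node) = path-node⇒ (S-leaves a∈S) (S-leaves b∈S) onPath node in
                        unique-node-between between y-node

module Quartets {N : ℕ} (t : Tree N) (i j l m : Fin N)
  (i-leaf : IsLeaf t i) (j-leaf : IsLeaf t j) (l-leaf : IsLeaf t l) (m-leaf : IsLeaf t m)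
  (i≢j : i ≢ j) (i≢l : i ≢ l) (i≢m : i ≢ m) (j≢l : j ≢ l) (j≢m : j ≢ m) (l≢m : l ≢ m) where
  open Tree t
  open Ancestry t
  open Branches t
  open Degrees t
  open Subtrees t
  open Medians t
  open EdgeSplits t

  S : List (Fin N)
  S = i ∷ j ∷ l ∷ m ∷ []

  S-members : ∀ {u} → u ∈ S → u ≡ i ⊎ u ≡ j ⊎ u ≡ l ⊎ u ≡ m
  S-members (here refl) = inj₁ refl
  S-members (there (here refl)) = inj₂ (inj₁ refl)
  S-members (there (there (here refl))) = inj₂ (inj₂ (inj₁ refl))
  S-members (there (there (there (here refl)))) = inj₂ (inj₂ (inj₂ refl))

  i∈S : i ∈ S
  i∈S = here refl
  j∈S : j ∈ S
  j∈S = there (here refl)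
  l∈S : l ∈ S
  l∈S = there (there (here refl))
  m∈S : m ∈ S
  m∈S = there (there (there (here refl)))

  S-leaves : ∀ {u} → u ∈ S → IsLeaf t u
  S-leaves uS with S-members uS
  ... | inj₁ refl = i-leaf
  ... | inj₂ (inj₁ refl) = j-leaf
  ... | inj₂ (inj₂ (inj₁ refl)) = l-leaf
  ... | inj₂ (inj₂ (inj₂ refl)) = m-leaf

  open NeighbourNodes t S S-leaves

  median-NodeOf : ∀ {x a b c} → a ∈ S → b ∈ S → c ∈ S → IsMedian x a b c → NodeOf S x
  median-NodeOf aS bS cS ((a≢x , b≢x , c≢x) , ¬ab , ¬ac , ¬bc) = _ , _ , _ , (aS , bS , cS) , (a≢x , b≢x , c≢x) , (¬ab , ¬ac , ¬bc)

  median-with-lm⇒quartet : ∀ {x} → IsMedian x i j l → SameBranch x l m → Quartet t i j l m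
  median-with-lm⇒quartet {x} x-med@((i≢x , j≢x , l≢x) , ¬ij , ¬il , ¬jl) lm with median l-leaf m-leaf i-leaf l≢m (λ e → i≢l (sym e)) (λ e → i≢m (sym e))
  ... | z , z-med@((l≢z , m≢z , i≢z) , ¬lm , ¬li , ¬mi) =
    neighbourNode⇒neighbours at-x , neighbourNode⇒neighbours at-z , ¬neighbours-il
    where
    S≢x : ∀ {u} → u ∈ S → u ≢ x
    S≢x uS = leaf-≢-branching (S-leaves uS) i≢x j≢x ¬ij
    at-x : NeighbourNode x i j l m
    at-x = record { S⊆abcd = S-members ; S≢x = S≢x ; a∈S = i∈S ; b∈S = j∈S ; c∈S = l∈S ; ¬ab = ¬ij ; ¬ac = ¬il ; ¬bc = ¬jl ; cd = lm }
    S≢z : ∀ {u} → u ∈ S → u ≢ z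
    S≢z uS = leaf-≢-branching (S-leaves uS) l≢z m≢z ¬lm
    z≢x : z ≢ x
    z≢x refl = ¬lm lm
    z-node : NodeOf S z
    z-node = median-NodeOf l∈S m∈S i∈S z-med
    lz : SameBranch x l z
    lz = other-node⇒branch-of-c at-x (λ x≡z → z≢x (sym x≡z)) z-node
    ix : SameBranch z i x
    ix = sameBranch-flip z≢x i≢z i≢x (λ iz → ¬il (sameBranch-trans iz (sameBranch-sym lz)))
    jx : SameBranch z j x
    jx = sameBranch-flip z≢x (S≢z j∈S) j≢x (λ jz → ¬jl (sameBranch-trans jz (sameBranch-sym lz)))
    at-z : NeighbourNode z l m i j
    at-z = record { S⊆abcd = λ uS → reorder (S-members uS) ; S≢x = S≢z ; a∈S = l∈S ; b∈S = m∈S ; c∈S = i∈S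
                  ; ¬ab = ¬lm ; ¬ac = ¬li ; ¬bc = ¬mi ; cd = sameBranch-trans ix (sameBranch-sym jx) }
      where
      reorder : ∀ {u} → u ≡ i ⊎ u ≡ j ⊎ u ≡ l ⊎ u ≡ m → u ≡ l ⊎ u ≡ m ⊎ u ≡ i ⊎ u ≡ j
      reorder (inj₁ e) = inj₂ (inj₂ (inj₁ e))
      reorder (inj₂ (inj₁ e)) = inj₂ (inj₂ (inj₂ e))
      reorder (inj₂ (inj₂ (inj₁ e))) = inj₁ e
      reorder (inj₂ (inj₂ (inj₂ e))) = inj₂ (inj₁ e)
    ¬neighbours-il : ¬ NeighboursIn t S i l
    ¬neighbours-il (_ , _ , unique) =
      z≢x (trans (unique z (between⇒onPath (i≢z , l≢z , ¬sameBranch-sym ¬li)) (NodeOf⇒node-of-subtree z-node))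
                 (sym (unique x (between⇒onPath (i≢x , l≢x , ¬il)) (NodeOf⇒node-of-subtree (median-NodeOf i∈S j∈S l∈S x-med)))))

  m-beside-i-or-j⇒¬neighbours-ij : ∀ {x} → IsMedian x i j l → SameBranch x m i ⊎ SameBranch x m j → ¬ NeighboursIn t S i j
  m-beside-i-or-j⇒¬neighbours-ij {x} x-med@((i≢x , j≢x , _) , ¬ij , _) m-beside (_ , _ , unique)
    with median i-leaf j-leaf m-leaf i≢j i≢m j≢m
  ... | y , y-med@((i≢y , j≢y , _) , ¬ij-at-y , ¬im , ¬jm) =
    x≢y m-beside (trans (unique x (between⇒onPath (i≢x , j≢x , ¬ij)) (NodeOf⇒node-of-subtree (median-NodeOf i∈S j∈S l∈S x-med)))
                        (sym (unique y (between⇒onPath (i≢y , j≢y , ¬ij-at-y)) (NodeOf⇒node-of-subtree (median-NodeOf i∈S j∈S m∈S y-med)))))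
    where
    x≢y : SameBranch x m i ⊎ SameBranch x m j → x ≢ y
    x≢y (inj₁ mi) refl = ¬im (sameBranch-sym mi)
    x≢y (inj₂ mj) refl = ¬jm (sameBranch-sym mj)

  m-apart⇒neighbours-il : ∀ {x} → IsMedian x i j l → ¬ SameBranch x m i → ¬ SameBranch x m j → ¬ SameBranch x m l →
                          NeighboursIn t S i l
  m-apart⇒neighbours-il {x} x-med@((i≢x , j≢x , l≢x) , ¬ij , ¬il , ¬jl) ¬mi ¬mj ¬ml =
    x , ⇒path-node (i≢x , l≢x , ¬il) (median-NodeOf i∈S j∈S l∈S x-med) ,
    λ y onPath node → unique (proj₂ (path-node⇒ i-leaf l-leaf onPath node))
    where
    S≢x : ∀ {u} → u ∈ S → u ≢ x
    S≢x uS = leaf-≢-branching (S-leaves uS) i≢x j≢x ¬ij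
    all-apart : ∀ {u v} → u ∈ S → v ∈ S → u ≢ v → ¬ SameBranch x u v
    all-apart uS vS u≢v uv with S-members uS | S-members vS
    ... | inj₁ refl | inj₁ refl = u≢v refl
    ... | inj₁ refl | inj₂ (inj₁ refl) = ¬ij uv
    ... | inj₁ refl | inj₂ (inj₂ (inj₁ refl)) = ¬il uv
    ... | inj₁ refl | inj₂ (inj₂ (inj₂ refl)) = ¬mi (sameBranch-sym uv)
    ... | inj₂ (inj₁ refl) | inj₁ refl = ¬ij (sameBranch-sym uv)
    ... | inj₂ (inj₁ refl) | inj₂ (inj₁ refl) = u≢v refl
    ... | inj₂ (inj₁ refl) | inj₂ (inj₂ (inj₁ refl)) = ¬jl uv
    ... | inj₂ (inj₁ refl) | inj₂ (inj₂ (inj₂ refl)) = ¬mj (sameBranch-sym uv)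
    ... | inj₂ (inj₂ (inj₁ refl)) | inj₁ refl = ¬il (sameBranch-sym uv)
    ... | inj₂ (inj₂ (inj₁ refl)) | inj₂ (inj₁ refl) = ¬jl (sameBranch-sym uv)
    ... | inj₂ (inj₂ (inj₁ refl)) | inj₂ (inj₂ (inj₁ refl)) = u≢v refl
    ... | inj₂ (inj₂ (inj₁ refl)) | inj₂ (inj₂ (inj₂ refl)) = ¬ml (sameBranch-sym uv)
    ... | inj₂ (inj₂ (inj₂ refl)) | inj₁ refl = ¬mi uv
    ... | inj₂ (inj₂ (inj₂ refl)) | inj₂ (inj₁ refl) = ¬mj uv
    ... | inj₂ (inj₂ (inj₂ refl)) | inj₂ (inj₂ (inj₁ refl)) = ¬ml uv
    ... | inj₂ (inj₂ (inj₂ refl)) | inj₂ (inj₂ (inj₂ refl)) = u≢v refl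
    unique : ∀ {y} → NodeOf S y → y ≡ x
    unique {y} y-node with x ≟ y
    ... | yes x≡y = sym x≡y
    ... | no x≢y with two-toward-other-node x≢y S≢x y-node
    ... | u , v , uS , vS , u≢v , uy , vy = ⊥-elim (all-apart uS vS u≢v (sameBranch-trans uy (sameBranch-sym vy)))

  median-ijl : ∃[ x ] IsMedian x i j l
  median-ijl = median i-leaf j-leaf l-leaf i≢j i≢l j≢l

  quartet⇒median : Quartet t i j l m → ∃[ x ] (IsMedian x i j l × SameBranch x l m)
  quartet⇒median (neighbours-ij , _ , ¬neighbours-il) with median-ijl
  ... | x , x-med@((i≢x , j≢x , l≢x) , ¬ij , _) with sameBranch? m≢x l≢x | sameBranch? m≢x i≢x | sameBranch? m≢x j≢x
    where m≢x = leaf-≢-branching m-leaf i≢x j≢x ¬ij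
  ... | yes ml | _ | _ = x , x-med , sameBranch-sym ml
  ... | no _ | yes mi | _ = ⊥-elim (m-beside-i-or-j⇒¬neighbours-ij x-med (inj₁ mi) neighbours-ij)
  ... | no _ | no _ | yes mj = ⊥-elim (m-beside-i-or-j⇒¬neighbours-ij x-med (inj₂ mj) neighbours-ij)
  ... | no ¬ml | no ¬mi | no ¬mj = ⊥-elim (¬neighbours-il (m-apart⇒neighbours-il x-med ¬mi ¬mj ¬ml))

  split⇒quartet : ∀ {e} → SplitsAt e i j l m → Quartet t i j l m
  split⇒quartet split with median-ijl
  ... | x , x-med@(_ , ¬ij , _) with split-side split x
  ... | inj₁ (_ , lm) = median-with-lm⇒quartet x-med lm
  ... | inj₂ (_ , ij) = ⊥-elim (¬ij ij)

count₂ : Bool → Bool → ℕ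
count₂ p q = (if p then 1 else 0) ℕ.+ (if q then 1 else 0)

module WeightedSums (R : RealField) where
  open RealField R using (ℝ; _+_; 0ℝ; isCommutativeRing)
  open Weighted R using (sumFin)

  ring : CommutativeRing 0ℓ 0ℓ
  ring = record { isCommutativeRing = isCommutativeRing }

  open CommutativeRing ring using (+-commutativeMonoid; +-commutativeSemigroup; +-group; +-monoid)
  open MonoidSum +-commutativeMonoid using (sum; ∑-distrib-+; sum-cong-≗; sum-remove)
  open GroupProperties +-group using (identityʳ-unique)
  open SemigroupProperties +-commutativeSemigroup using (xy∙z≈xz∙y)
  open ≡-Reasoning

  sumFin≡sum : ∀ {N} (f : Fin N → ℝ) → sumFin f ≡ sum f
  sumFin≡sum {zero} f = refl
  sumFin≡sum {suc N} f = cong (f zero +_) (sumFin≡sum (λ e → f (suc e)))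

  sumFin-+ : ∀ {N} (f g : Fin N → ℝ) → sumFin f + sumFin g ≡ sumFin (λ e → f e + g e)
  sumFin-+ f g = begin
    sumFin f + sumFin g             ≡⟨ cong₂ _+_ (sumFin≡sum f) (sumFin≡sum g) ⟩
    sum f + sum g                   ≡⟨ sym (∑-distrib-+ f g) ⟩
    sum (λ e → f e + g e)           ≡⟨ sym (sumFin≡sum (λ e → f e + g e)) ⟩
    sumFin (λ e → f e + g e)        ∎

  sumFin-cong : ∀ {N} (f g : Fin N → ℝ) → (∀ e → f e ≡ g e) → sumFin f ≡ sumFin g
  sumFin-cong f g f≗g = trans (sumFin≡sum f) (trans (sum-cong-≗ f≗g) (sym (sumFin≡sum g)))

  sumFin-bump : ∀ {N} (f g : Fin N → ℝ) (e₀ : Fin N) (δ : ℝ) → (∀ e → e ≢ e₀ → g e ≡ f e) → g e₀ ≡ f e₀ + δ →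
                sumFin g ≡ sumFin f + δ
  sumFin-bump {suc N} f g e₀ δ elsewhere at-e₀ = begin
    sumFin g                                   ≡⟨ sumFin≡sum g ⟩
    sum g                                      ≡⟨ sum-remove {i = e₀} g ⟩
    g e₀ + sum (λ e → g (punchIn e₀ e))        ≡⟨ cong₂ _+_ at-e₀ (sum-cong-≗ (λ e → elsewhere _ (punchInᵢ≢i e₀ e))) ⟩
    (f e₀ + δ) + sum (λ e → f (punchIn e₀ e))   ≡⟨ xy∙z≈xz∙y (f e₀) δ _ ⟩
    (f e₀ + sum (λ e → f (punchIn e₀ e))) + δ   ≡⟨ cong (_+ δ) (sym (sum-remove {i = e₀} f)) ⟩
    sum f + δ                                  ≡⟨ cong (_+ δ) (sym (sumFin≡sum f)) ⟩
    sumFin f + δ                               ∎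

  open MultProperties +-monoid using (×-homo-1; ×-homo-+) renaming (_×_ to _·_)

  weight : Bool → ℝ → ℝ
  weight b x = if b then x else 0ℝ

  weight≡· : ∀ b x → weight b x ≡ (if b then 1 else 0) · x
  weight≡· true x = sym (×-homo-1 x)
  weight≡· false x = refl

  weight₂≡count₂· : ∀ p q x → weight p x + weight q x ≡ count₂ p q · x
  weight₂≡count₂· p q x = trans (cong₂ _+_ (weight≡· p x) (weight≡· q x)) (sym (×-homo-+ x (if p then 1 else 0) _))

  module EdgewiseComparison {N : ℕ} (w : Fin N → ℝ) (pL qL pR qR : Fin N → Bool) where
    wpL wqL wpR wqR termL termR : Fin N → ℝ
    wpL e = weight (pL e) (w e)
    wqL e = weight (qL e) (w e)
    wpR e = weight (pR e) (w e)
    wqR e = weight (qR e) (w e)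
    termL e = wpL e + wqL e
    termR e = wpR e + wqR e

    LHS RHS : ℝ
    LHS = sumFin wpL + sumFin wqL
    RHS = sumFin wpR + sumFin wqR

    CountsAgree : Fin N → Set
    CountsAgree e = count₂ (pL e) (qL e) ≡ count₂ (pR e) (qR e)

    agree⇒terms≡ : ∀ {e} → CountsAgree e → termL e ≡ termR e
    agree⇒terms≡ {e} agree = begin
      termL e                            ≡⟨ weight₂≡count₂· (pL e) (qL e) (w e) ⟩
      count₂ (pL e) (qL e) · w e         ≡⟨ cong (_· w e) agree ⟩
      count₂ (pR e) (qR e) · w e         ≡⟨ sym (weight₂≡count₂· (pR e) (qR e) (w e)) ⟩
      termR e                            ∎

    counts-agree⇒LHS≡RHS : (∀ e → CountsAgree e) → LHS ≡ RHS
    counts-agree⇒LHS≡RHS agree =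
      trans (sumFin-+ wpL wqL) (trans (sumFin-cong termL termR (λ e → agree⇒terms≡ (agree e))) (sym (sumFin-+ wpR wqR)))

    LHS≢RHS⇒disagreement : LHS ≢ RHS → ∃[ e ] (¬ CountsAgree e)
    LHS≢RHS⇒disagreement LHS≢RHS =
      ¬∀⟶∃¬ N CountsAgree (λ e → count₂ (pL e) (qL e) ℕ.≟ count₂ (pR e) (qR e)) (λ agree → LHS≢RHS (counts-agree⇒LHS≡RHS agree))

    single-disagreement⇒LHS≢RHS : ∀ g → (∀ e → ¬ CountsAgree e → e ≡ g) →
                                  count₂ (pL g) (qL g) ≡ 1 → pR g ≡ true → qR g ≡ true → w g ≢ 0ℝ → LHS ≢ RHS
    single-disagreement⇒LHS≢RHS g only-g one-left both-right both-right′ w≢0 LHS≡RHS =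
      w≢0 (identityʳ-unique LHS (w g) (trans (sym RHS≡LHS+w) (sym LHS≡RHS)))
      where
      at-g : termR g ≡ termL g + w g
      at-g = begin
        termR g                                   ≡⟨ weight₂≡count₂· (pR g) (qR g) (w g) ⟩
        count₂ (pR g) (qR g) · w g                ≡⟨ cong (_· w g) (cong₂ count₂ both-right both-right′) ⟩
        2 · w g                                   ≡⟨ ×-homo-+ (w g) 1 1 ⟩
        1 · w g + 1 · w g                         ≡⟨ cong₂ _+_ (cong (_· w g) (sym one-left)) (×-homo-1 (w g)) ⟩
        count₂ (pL g) (qL g) · w g + w g          ≡⟨ cong (_+ w g) (sym (weight₂≡count₂· (pL g) (qL g) (w g))) ⟩
        termL g + w g                             ∎
      agree-off-g : ∀ e → e ≢ g → CountsAgree e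
      agree-off-g e e≢g with count₂ (pL e) (qL e) ℕ.≟ count₂ (pR e) (qR e)
      ... | yes agree = agree
      ... | no disagree = ⊥-elim (e≢g (only-g e disagree))
      RHS≡LHS+w : RHS ≡ LHS + w g
      RHS≡LHS+w = begin
        RHS                                ≡⟨ sumFin-+ wpR wqR ⟩
        sumFin termR                       ≡⟨ sumFin-bump termL termR g (w g) (λ e e≢g → sym (agree⇒terms≡ (agree-off-g e e≢g))) at-g ⟩
        sumFin termL + w g                 ≡⟨ cong (_+ w g) (sym (sumFin-+ wpL wqL)) ⟩
        LHS + w g                          ∎

∀ᵇ : (Bool → Bool) → Bool
∀ᵇ p = p true ∧ p false

∀ᵇ-sound : ∀ p → T (∀ᵇ p) → ∀ b → T (p b)
∀ᵇ-sound p h true = proj₁ (to (T-∧ {p true}) h)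
∀ᵇ-sound p h false = proj₂ (to (T-∧ {p true}) h)

decide-Bool⁶ : {P : Bool → Bool → Bool → Bool → Bool → Bool → Set} (P? : ∀ a b c d e f → Dec (P a b c d e f)) →
               T (∀ᵇ λ a → ∀ᵇ λ b → ∀ᵇ λ c → ∀ᵇ λ d → ∀ᵇ λ e → ∀ᵇ λ f → ⌊ P? a b c d e f ⌋) →
               ∀ a b c d e f → P a b c d e f
decide-Bool⁶ P? h a b c d e f =
  toWitness (∀ᵇ-sound (λ f → ⌊ P? a b c d e f ⌋)
            (∀ᵇ-sound (λ e → ∀ᵇ λ f → ⌊ P? a b c d e f ⌋)
            (∀ᵇ-sound (λ d → ∀ᵇ λ e → ∀ᵇ λ f → ⌊ P? a b c d e f ⌋)
            (∀ᵇ-sound (λ c → ∀ᵇ λ d → ∀ᵇ λ e → ∀ᵇ λ f → ⌊ P? a b c d e f ⌋)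
            (∀ᵇ-sound (λ b → ∀ᵇ λ c → ∀ᵇ λ d → ∀ᵇ λ e → ∀ᵇ λ f → ⌊ P? a b c d e f ⌋)
            (∀ᵇ-sound (λ a → ∀ᵇ λ b → ∀ᵇ λ c → ∀ᵇ λ d → ∀ᵇ λ e → ∀ᵇ λ f → ⌊ P? a b c d e f ⌋) h a) b) c) d) e) f)

split4? : ∀ p q u v → Dec (Split4 p q u v)
split4? p q u v = (p Bool.≟ q) ×-dec ((u Bool.≟ v) ×-dec ¬? (p Bool.≟ u))

-- spans₃ (isEdge t e) (below t a e) (below t b e) (below t c e) is inSub t (a ∷ b ∷ c ∷ []) e by computation.
spans₃ : Bool → Bool → Bool → Bool → Bool
spans₃ E x y z = E ∧ ((x ∨ (y ∨ (z ∨ false))) ∧ (not x ∨ (not y ∨ (not z ∨ false))))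

-- Each shape lemma is a statement about six bits, proved by evaluating its decision on all 64 inputs.
shape-A : ∀ E a b c d r → count₂ (spans₃ E a b c) (spans₃ E d r c) ≢ count₂ (spans₃ E a r c) (spans₃ E d b c) →
          T E × (Split4 a b d r ⊎ Split4 a r b d)
shape-A = decide-Bool⁶ (λ E a b c d r →
  ¬? (count₂ (spans₃ E a b c) (spans₃ E d r c) ℕ.≟ count₂ (spans₃ E a r c) (spans₃ E d b c)) →-dec
  (T? E ×-dec (split4? a b d r ⊎-dec split4? a r b d))) _

shape-B₁ : ∀ E a b c d r → count₂ (spans₃ E a b r) (spans₃ E d c r) ≢ count₂ (spans₃ E a d r) (spans₃ E b c r) →
           T E × (Split4 a b c d ⊎ Split4 a d b c)
shape-B₁ = decide-Bool⁶ (λ E a b c d r →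
  ¬? (count₂ (spans₃ E a b r) (spans₃ E d c r) ℕ.≟ count₂ (spans₃ E a d r) (spans₃ E b c r)) →-dec
  (T? E ×-dec (split4? a b c d ⊎-dec split4? a d b c))) _

shape-B₂ : ∀ E a b c d r → count₂ (spans₃ E a b r) (spans₃ E d c r) ≢ count₂ (spans₃ E a c r) (spans₃ E b d r) →
           T E × (Split4 a b c d ⊎ Split4 a c b d)
shape-B₂ = decide-Bool⁶ (λ E a b c d r →
  ¬? (count₂ (spans₃ E a b r) (spans₃ E d c r) ℕ.≟ count₂ (spans₃ E a c r) (spans₃ E b d r)) →-dec
  (T? E ×-dec (split4? a b c d ⊎-dec split4? a c b d))) _

count-gap-A : ∀ E a b c d r → E ≡ true → b ≡ a → d ≡ c → r ≡ c → a ≢ c →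
              count₂ (spans₃ E a b c) (spans₃ E d r c) ≡ 1 × spans₃ E a r c ≡ true × spans₃ E d b c ≡ true
count-gap-A = decide-Bool⁶ (λ E a b c d r →
  (E Bool.≟ true) →-dec ((b Bool.≟ a) →-dec ((d Bool.≟ c) →-dec ((r Bool.≟ c) →-dec (¬? (a Bool.≟ c) →-dec
  ((count₂ (spans₃ E a b c) (spans₃ E d r c) ℕ.≟ 1) ×-dec ((spans₃ E a r c Bool.≟ true) ×-dec (spans₃ E d b c Bool.≟ true)))))))) _

count-gap-B₁ : ∀ E a b c d r → E ≡ true → b ≡ a → d ≡ c → a ≢ c →
               count₂ (spans₃ E a b r) (spans₃ E d c r) ≡ 1 × spans₃ E a d r ≡ true × spans₃ E b c r ≡ true
count-gap-B₁ = decide-Bool⁶ (λ E a b c d r →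
  (E Bool.≟ true) →-dec ((b Bool.≟ a) →-dec ((d Bool.≟ c) →-dec (¬? (a Bool.≟ c) →-dec
  ((count₂ (spans₃ E a b r) (spans₃ E d c r) ℕ.≟ 1) ×-dec ((spans₃ E a d r Bool.≟ true) ×-dec (spans₃ E b c r Bool.≟ true))))))) _

count-gap-B₂ : ∀ E a b c d r → E ≡ true → b ≡ a → d ≡ c → a ≢ c →
               count₂ (spans₃ E a b r) (spans₃ E d c r) ≡ 1 × spans₃ E a c r ≡ true × spans₃ E b d r ≡ true
count-gap-B₂ = decide-Bool⁶ (λ E a b c d r →
  (E Bool.≟ true) →-dec ((b Bool.≟ a) →-dec ((d Bool.≟ c) →-dec (¬? (a Bool.≟ c) →-dec
  ((count₂ (spans₃ E a b r) (spans₃ E d c r) ℕ.≟ 1) ×-dec ((spans₃ E a c r Bool.≟ true) ×-dec (spans₃ E b d r Bool.≟ true))))))) _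

module SplitDetection (R : RealField) {N : ℕ} (t : Tree N) (w : Fin N → RealField.ℝ R) where
  open RealField R using (ℝ; _+_; 0ℝ)
  open Weighted R using (D)
  open WeightedSums R
  open Sides t
  open EdgeSplits t

  D₃ : Fin N → Fin N → Fin N → ℝ
  D₃ a b c = D t w (a ∷ b ∷ c ∷ [])

  span : Fin N → Fin N → Fin N → Fin N → Bool
  span a b c e = inSub t (a ∷ b ∷ c ∷ []) e

  disagreement-A⇒split : ∀ a b c d r e → count₂ (span a b c e) (span d r c e) ≢ count₂ (span a r c e) (span d b c e) →
                         SplitsAt e a b d r ⊎ SplitsAt e a r b d
  disagreement-A⇒split a b c d r e ne with shape-A (isEdge t e) (below t a e) (below t b e) (below t c e) (below t d e) (below t r e) ne
  ... | isE , inj₁ s = inj₁ (isEdge⇒ isE , s)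
  ... | isE , inj₂ s = inj₂ (isEdge⇒ isE , s)

  disagreement-B₁⇒split : ∀ a b c d r e → count₂ (span a b r e) (span d c r e) ≢ count₂ (span a d r e) (span b c r e) →
                          SplitsAt e a b c d ⊎ SplitsAt e a d b c
  disagreement-B₁⇒split a b c d r e ne with shape-B₁ (isEdge t e) (below t a e) (below t b e) (below t c e) (below t d e) (below t r e) ne
  ... | isE , inj₁ s = inj₁ (isEdge⇒ isE , s)
  ... | isE , inj₂ s = inj₂ (isEdge⇒ isE , s)

  disagreement-B₂⇒split : ∀ a b c d r e → count₂ (span a b r e) (span d c r e) ≢ count₂ (span a c r e) (span b d r e) →
                          SplitsAt e a b c d ⊎ SplitsAt e a c b d
  disagreement-B₂⇒split a b c d r e ne with shape-B₂ (isEdge t e) (below t a e) (below t b e) (below t c e) (below t d e) (below t r e) ne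
  ... | isE , inj₁ s = inj₁ (isEdge⇒ isE , s)
  ... | isE , inj₂ s = inj₂ (isEdge⇒ isE , s)

  four-point-A : ∀ a b c d r → D₃ a b c + D₃ d r c ≢ D₃ a r c + D₃ d b c → ∃[ e ] (SplitsAt e a b d r ⊎ SplitsAt e a r b d)
  four-point-A a b c d r ineq with EdgewiseComparison.LHS≢RHS⇒disagreement w (span a b c) (span d r c) (span a r c) (span d b c) ineq
  ... | e , disagree = e , disagreement-A⇒split a b c d r e disagree

  four-point-B₁ : ∀ a b c d r → D₃ a b r + D₃ d c r ≢ D₃ a d r + D₃ b c r → ∃[ e ] (SplitsAt e a b c d ⊎ SplitsAt e a d b c)
  four-point-B₁ a b c d r ineq with EdgewiseComparison.LHS≢RHS⇒disagreement w (span a b r) (span d c r) (span a d r) (span b c r) ineq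
  ... | e , disagree = e , disagreement-B₁⇒split a b c d r e disagree

  four-point-B₂ : ∀ a b c d r → D₃ a b r + D₃ d c r ≢ D₃ a c r + D₃ b d r → ∃[ e ] (SplitsAt e a b c d ⊎ SplitsAt e a c b d)
  four-point-B₂ a b c d r ineq with EdgewiseComparison.LHS≢RHS⇒disagreement w (span a b r) (span d c r) (span a c r) (span b d r) ineq
  ... | e , disagree = e , disagreement-B₂⇒split a b c d r e disagree

  isEdge≡true : ∀ {g} → g ≢ Tree.root t → isEdge t g ≡ true
  isEdge≡true g≢root = to T-≡ (⇒isEdge g≢root)

  single-split-A : ∀ a b c d r g → (∀ e → SplitsAt e a b d r → e ≡ g) → (∀ e → ¬ SplitsAt e a r b d) → g ≢ Tree.root t →
                   below t b g ≡ below t a g → below t d g ≡ below t c g → below t r g ≡ below t c g → below t a g ≢ below t c g →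
                   w g ≢ 0ℝ → D₃ a b c + D₃ d r c ≢ D₃ a r c + D₃ d b c
  single-split-A a b c d r g only-g never g≢root b≡a d≡c r≡c a≢c w≢0 =
    EdgewiseComparison.single-disagreement⇒LHS≢RHS w (span a b c) (span d r c) (span a r c) (span d b c) g
      (λ e ne → [ only-g e , (λ s → ⊥-elim (never e s)) ]′ (disagreement-A⇒split a b c d r e ne))
      (proj₁ gap) (proj₁ (proj₂ gap)) (proj₂ (proj₂ gap)) w≢0
    where
    gap = count-gap-A (isEdge t g) (below t a g) (below t b g) (below t c g) (below t d g) (below t r g)
            (isEdge≡true g≢root) b≡a d≡c r≡c a≢c

  single-split-B₁ : ∀ a b c d r g → (∀ e → SplitsAt e a b c d → e ≡ g) → (∀ e → ¬ SplitsAt e a d b c) → g ≢ Tree.root t →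
                    below t b g ≡ below t a g → below t d g ≡ below t c g → below t a g ≢ below t c g →
                    w g ≢ 0ℝ → D₃ a b r + D₃ d c r ≢ D₃ a d r + D₃ b c r
  single-split-B₁ a b c d r g only-g never g≢root b≡a d≡c a≢c w≢0 =
    EdgewiseComparison.single-disagreement⇒LHS≢RHS w (span a b r) (span d c r) (span a d r) (span b c r) g
      (λ e ne → [ only-g e , (λ s → ⊥-elim (never e s)) ]′ (disagreement-B₁⇒split a b c d r e ne))
      (proj₁ gap) (proj₁ (proj₂ gap)) (proj₂ (proj₂ gap)) w≢0
    where
    gap = count-gap-B₁ (isEdge t g) (below t a g) (below t b g) (below t c g) (below t d g) (below t r g)
            (isEdge≡true g≢root) b≡a d≡c a≢c

  single-split-B₂ : ∀ a b c d r g → (∀ e → SplitsAt e a b c d → e ≡ g) → (∀ e → ¬ SplitsAt e a c b d) → g ≢ Tree.root t →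
                    below t b g ≡ below t a g → below t d g ≡ below t c g → below t a g ≢ below t c g →
                    w g ≢ 0ℝ → D₃ a b r + D₃ d c r ≢ D₃ a c r + D₃ b d r
  single-split-B₂ a b c d r g only-g never g≢root b≡a d≡c a≢c w≢0 =
    EdgewiseComparison.single-disagreement⇒LHS≢RHS w (span a b r) (span d c r) (span a c r) (span b d r) g
      (λ e ne → [ only-g e , (λ s → ⊥-elim (never e s)) ]′ (disagreement-B₂⇒split a b c d r e ne))
      (proj₁ gap) (proj₁ (proj₂ gap)) (proj₂ (proj₂ gap)) w≢0
    where
    gap = count-gap-B₂ (isEdge t g) (below t a g) (below t b g) (below t c g) (below t d g) (below t r g)
            (isEdge≡true g≢root) b≡a d≡c a≢c

fifth-element : ∀ {n} → 5 ≤ n → (i j l m : Fin n) → ∃[ r ] (r ≢ i × r ≢ j × r ≢ l × r ≢ m)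
fifth-element {n} 5≤n i j l m with ¬∀⟶∃¬ n One-of (λ r → (r ≟ i) ⊎-dec ((r ≟ j) ⊎-dec ((r ≟ l) ⊎-dec (r ≟ m)))) ¬all
  where
  One-of : Fin n → Set
  One-of r = r ≡ i ⊎ r ≡ j ⊎ r ≡ l ⊎ r ≡ m
  element : Fin 4 → Fin n
  element zero = i
  element (suc zero) = j
  element (suc (suc zero)) = l
  element (suc (suc (suc zero))) = m
  index : ∀ {r} → One-of r → Σ (Fin 4) λ k → r ≡ element k
  index (inj₁ p) = zero , p
  index (inj₂ (inj₁ p)) = suc zero , p
  index (inj₂ (inj₂ (inj₁ p))) = suc (suc zero) , p
  index (inj₂ (inj₂ (inj₂ p))) = suc (suc (suc zero)) , p
  ¬all : ¬ (∀ r → One-of r)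
  ¬all all with pigeonhole 5≤n (λ r → proj₁ (index (all r)))
  ... | a , b , a<b , same = <⇒≢ a<b (trans (proj₂ (index (all a))) (trans (cong element same) (sym (proj₂ (index (all b))))))
... | r , ¬one = r , (λ p → ¬one (inj₁ p)) , (λ p → ¬one (inj₂ (inj₁ p))) , (λ p → ¬one (inj₂ (inj₂ (inj₁ p)))) ,
                 (λ p → ¬one (inj₂ (inj₂ (inj₂ p))))

module Proposition (R : RealField) {n N : ℕ} (P : Tree N) (w : Fin N → RealField.ℝ R) (leaf : Fin n → Fin N)
  (leaf-set : LeafSet P leaf) (i j l m : Fin n)
  (i≢j : i ≢ j) (i≢l : i ≢ l) (i≢m : i ≢ m) (j≢l : j ≢ l) (j≢m : j ≢ m) (l≢m : l ≢ m) where
  open RealField R using (ℝ; 0ℝ)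
  open Weighted R using (CondA; CondB; InternalNonzero; Outside)
  open Ancestry P
  open Branches P
  open Sides P
  open Degrees P
  open Medians P
  open EdgeSplits P
  open SplitDetection R P w

  leaf-injective : ∀ {a b} → a ≢ b → leaf a ≢ leaf b
  leaf-injective a≢b e = a≢b (proj₁ leaf-set e)

  leaf-isLeaf : ∀ k → IsLeaf P (leaf k)
  leaf-isLeaf k = from (proj₂ leaf-set (leaf k)) (k , refl)

  vi vj vl vm : Fin N
  vi = leaf i
  vj = leaf j
  vl = leaf l
  vm = leaf m

  open Quartets P vi vj vl vm (leaf-isLeaf i) (leaf-isLeaf j) (leaf-isLeaf l) (leaf-isLeaf m)
    (leaf-injective i≢j) (leaf-injective i≢l) (leaf-injective i≢m) (leaf-injective j≢l) (leaf-injective j≢m) (leaf-injective l≢m)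

  quartet-from-B-splits : ∀ {e f} → SplitsAt e vi vj vl vm ⊎ SplitsAt e vi vm vj vl → SplitsAt f vi vj vl vm ⊎ SplitsAt f vi vl vj vm →
                          Quartet P vi vj vl vm
  quartet-from-B-splits (inj₁ split) _ = split⇒quartet split
  quartet-from-B-splits _ (inj₁ split) = split⇒quartet split
  quartet-from-B-splits (inj₂ im∣jl) (inj₂ il∣jm) = ⊥-elim (splits-incompatible (splitsAt-swapʳ im∣jl) (splitsAt-swapʳ il∣jm))

  condB⇒quartet : ∀ {r} → Outside P w leaf i j l m r → CondB P w leaf i j l m → Quartet P vi vj vl vm
  condB⇒quartet {r} out condB =
    quartet-from-B-splits (proj₂ (four-point-B₁ vi vj vl vm (leaf r) (proj₁ (condB r out))))
                          (proj₂ (four-point-B₂ vi vj vl vm (leaf r) (proj₂ (condB r out))))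

  split-ij-from : ∀ {x r} → ∃[ e ] (SplitsAt e vi vj x r ⊎ SplitsAt e vi r vj x) → ∃[ e ] (SplitsAt e vj vi x r ⊎ SplitsAt e vj r vi x) →
                  ∃[ e ] SplitsAt e vi vj x r
  split-ij-from (e , inj₁ split) _ = e , split
  split-ij-from _ (f , inj₁ split) = f , splitsAt-swapˡ split
  split-ij-from (e , inj₂ ir∣jx) (f , inj₂ jr∣ix) = ⊥-elim (splits-incompatible (splitsAt-swapˡ ir∣jx) (splitsAt-swapˡ jr∣ix))

  quartet-from-A-splits : ∀ {e f r} → SplitsAt e vi vj vm r → SplitsAt f vi vj vl r → Quartet P vi vj vl vm
  quartet-from-A-splits {e} {f} {r} ij∣mr ij∣lr = combine (splitsAt-extend ij∣mr vl) (splitsAt-extend ij∣lr vm)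
    where
    combine : SplitsAt e vi vj vl vm ⊎ SplitsAt e vl vi r vm → SplitsAt f vi vj vm vl ⊎ SplitsAt f vm vi r vl →
              Quartet P vi vj vl vm
    combine (inj₁ ij∣lm) _ = split⇒quartet ij∣lm
    combine _ (inj₁ ij∣ml) = split⇒quartet (splitsAt-swapʳ ij∣ml)
    combine (inj₂ li∣rm) (inj₂ mi∣rl) = ⊥-elim (splits-incompatible li∣rm (splitsAt-swapʳ (splitsAt-swapˡ (splitsAt-sym mi∣rl))))

  condA⇒quartet : CondA P w leaf i j l m → Quartet P vi vj vl vm
  condA⇒quartet (r , _ , ineq₁ , ineq₂ , ineq₃ , ineq₄) =
    quartet-from-A-splits
      (proj₂ (split-ij-from (four-point-A vi vj vl vm (leaf r) ineq₁) (four-point-A vj vi vl vm (leaf r) ineq₂)))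
      (proj₂ (split-ij-from (four-point-A vi vj vm vl (leaf r) ineq₃) (four-point-A vj vi vm vl (leaf r) ineq₄)))

  module Forward (essential : Essential P) (nonzero : InternalNonzero P w)
    {x : Fin N} (x-med : IsMedian x vi vj vl) (lm : SameBranch x vl vm) where

    i≢x : vi ≢ x
    i≢x = proj₁ (proj₁ x-med)
    j≢x : vj ≢ x
    j≢x = proj₁ (proj₂ (proj₁ x-med))
    l≢x : vl ≢ x
    l≢x = proj₂ (proj₂ (proj₁ x-med))
    ¬ij : ¬ SameBranch x vi vj
    ¬ij = proj₁ (proj₂ x-med)
    ¬il : ¬ SameBranch x vi vl
    ¬il = proj₁ (proj₂ (proj₂ x-med))
    ¬jl : ¬ SameBranch x vj vl
    ¬jl = proj₂ (proj₂ (proj₂ x-med))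
    ¬im : ¬ SameBranch x vi vm
    ¬im im = ¬il (sameBranch-trans im (sameBranch-sym lm))
    ¬jm : ¬ SameBranch x vj vm
    ¬jm jm = ¬jl (sameBranch-trans jm (sameBranch-sym lm))
    leaf≢x : ∀ k → leaf k ≢ x
    leaf≢x k = leaf-≢-branching (leaf-isLeaf k) i≢x j≢x ¬ij

    g : Fin N
    g = proj₁ (toward-exists l≢x)
    toward-l : Toward x g vl
    toward-l = proj₂ (toward-exists l≢x)
    sameBranch⇒toward-g : ∀ {a} → SameBranch x a vl → Toward x g a
    sameBranch⇒toward-g (e , fa , fl) = subst (λ e → Toward x e _) (toward-unique fl toward-l) fa
    toward-m : Toward x g vm
    toward-m = sameBranch⇒toward-g (sameBranch-sym lm)
    ¬toward-i : ¬ Toward x g vi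
    ¬toward-i fi = ¬il (g , fi , toward-l)
    ¬toward-j : ¬ Toward x g vj
    ¬toward-j fj = ¬jl (g , fj , toward-l)
    g≢root : g ≢ Tree.root P
    g≢root = toward-edge toward-l

    q : Fin N
    q = proj₁ (toward-adjacent toward-l)
    adj : Adjacent x g q
    adj = proj₂ (toward-adjacent toward-l)
    x≢q : x ≢ q
    x≢q e = adjacent-≢ adj (sym e)
    ¬lx-at-q : ¬ SameBranch q vl x
    ¬lx-at-q = beyond⇒¬sameBranch adj toward-l
    leaf-toward-g-≢q : ∀ {a b} → IsLeaf P a → Toward x g a → Toward x g b → a ≢ b → a ≢ q
    leaf-toward-g-≢q a-leaf fa fb a≢b refl =
      beyond⇒¬sameBranch adj fb (leaf-sameBranch a-leaf (λ b≡a → a≢b (sym b≡a)) x≢q)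
    l≢q : vl ≢ q
    l≢q = leaf-toward-g-≢q (leaf-isLeaf l) toward-l toward-m (leaf-injective l≢m)
    m≢q : vm ≢ q
    m≢q = leaf-toward-g-≢q (leaf-isLeaf m) toward-m toward-l (λ e → leaf-injective l≢m (sym e))
    h : Fin N
    h = proj₁ (toward-exists l≢q)
    toward-l-at-q : Toward q h vl
    toward-l-at-q = proj₂ (toward-exists l≢q)
    g≢h : g ≢ h
    g≢h g≡h = ¬lx-at-q (h , toward-l-at-q , subst (λ e → Toward q e x) g≡h (adjacent-back adj))

    third-at-q : IsNode P q × ∃[ h′ ] (Incident q h′ × h′ ≢ g × h′ ≢ h)
    third-at-q = essential-third-edge essential (toward-incident (adjacent-back adj)) (toward-incident toward-l-at-q) g≢h

    w≢0 : w g ≢ 0ℝ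
    w≢0 = nonzero g (edge-between-nodes-internal adj (three-branches⇒node i≢x j≢x l≢x ¬ij ¬il ¬jl) (proj₁ third-at-q))

    split-between-x-and-q : ∀ {e a b c d} → ¬ SameBranch x a b → ¬ SameBranch q c d → SplitsAt e a b c d → e ≡ g
    split-between-x-and-q ¬ab ¬cd split@(_ , _ , _ , a≢c) with split-side split x | split-side split q
    ... | inj₂ (_ , ab) | _ = ⊥-elim (¬ab ab)
    ... | _ | inj₁ (_ , cd) = ⊥-elim (¬cd cd)
    ... | inj₁ (x-side , _) | inj₂ (q-side , _) =
      separating-adjacentᵇ adj (λ x≡q → a≢c (trans (sym x-side) (trans x≡q q-side)))

    ¬toward-vs-toward : ∀ {a b} → ¬ Toward x g a → Toward x g b → ¬ SameBranch x a b
    ¬toward-vs-toward ¬fa fb (e , fa , fb′) = ¬fa (subst (λ e → Toward x e _) (toward-unique fb′ fb) fa)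

    sides-at-g : ∀ {a b c d} → ¬ Toward x g a → ¬ Toward x g b → Toward x g c → Toward x g d →
                 below P b g ≡ below P a g × below P d g ≡ below P c g × below P a g ≢ below P c g
    sides-at-g ¬fa ¬fb fc fd =
      ¬toward-below≡ (toward-incident fc) ¬fb ¬fa , toward-below≡ fd fc , λ a≡c → toward-¬toward-below≢ fc ¬fa (sym a≡c)

    condB : ¬ SameBranch q vl vm → CondB P w leaf i j l m
    condB ¬lm-at-q r _ =
      single-split-B₁ vi vj vl vm (leaf r) g only-g (λ e → ¬split-at x ¬im ¬jl) g≢root j∼i m∼l i≁l w≢0 ,
      single-split-B₂ vi vj vl vm (leaf r) g only-g (λ e → ¬split-at x ¬il ¬jm) g≢root j∼i m∼l i≁l w≢0
      where
      only-g : ∀ e → SplitsAt e vi vj vl vm → e ≡ g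
      only-g e = split-between-x-and-q ¬ij ¬lm-at-q
      sides = sides-at-g ¬toward-i ¬toward-j toward-l toward-m
      j∼i = proj₁ sides
      m∼l = proj₁ (proj₂ sides)
      i≁l = proj₂ (proj₂ sides)

    module ThirdLeaf (lm-at-q : SameBranch q vl vm) where
      h′ : Fin N
      h′ = proj₁ (proj₂ third-at-q)
      h′≢g : h′ ≢ g
      h′≢g = proj₁ (proj₂ (proj₂ (proj₂ third-at-q)))
      h′≢h : h′ ≢ h
      h′≢h = proj₂ (proj₂ (proj₂ (proj₂ third-at-q)))
      leaf-beyond-h′ : ∃[ v ] (IsLeaf P v × Toward q h′ v)
      leaf-beyond-h′ = leaf-toward essential (proj₁ (proj₂ (proj₂ third-at-q)))

      r : Fin n
      r = proj₁ (to (proj₂ leaf-set _) (proj₁ (proj₂ leaf-beyond-h′)))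
      vr : Fin N
      vr = leaf r
      toward-r-at-q : Toward q h′ vr
      toward-r-at-q = subst (Toward q h′) (sym (proj₂ (to (proj₂ leaf-set _) (proj₁ (proj₂ leaf-beyond-h′)))))
                        (proj₂ (proj₂ leaf-beyond-h′))

      different-branch-at-q : ∀ {a e} → Toward q e a → e ≢ h′ → ¬ SameBranch q a vr
      different-branch-at-q fa e≢h′ (d , fa′ , fr) = e≢h′ (trans (toward-unique fa fa′) (toward-unique fr toward-r-at-q))

      ¬lr-at-q : ¬ SameBranch q vl vr
      ¬lr-at-q = different-branch-at-q toward-l-at-q (λ h≡h′ → h′≢h (sym h≡h′))
      ¬mr-at-q : ¬ SameBranch q vm vr
      ¬mr-at-q mr = ¬lr-at-q (sameBranch-trans lm-at-q mr)

      toward-r : Toward x g vr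
      toward-r = sameBranch⇒toward-g (sameBranch-trans r-toward-q (g , adjacent-toward adj , toward-l))
        where
        r-toward-q : SameBranch x vr q
        r-toward-q = sameBranch-flip x≢q (leaf≢x r) (toward-≢ toward-r-at-q)
                       (λ rx → different-branch-at-q (adjacent-back adj) (λ g≡h′ → h′≢g (sym g≡h′)) (sameBranch-sym rx))

      outside : Outside P w leaf i j l m r
      outside = (λ r≡i → ¬toward-i (subst (λ k → Toward x g (leaf k)) r≡i toward-r)) ,
                (λ r≡j → ¬toward-j (subst (λ k → Toward x g (leaf k)) r≡j toward-r)) ,
                (λ r≡l → ¬lr-at-q (subst (λ k → SameBranch q vl (leaf k)) (sym r≡l) (sameBranch-refl l≢q))) ,
                (λ r≡m → ¬mr-at-q (subst (λ k → SameBranch q vm (leaf k)) (sym r≡m) (sameBranch-refl m≢q)))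

      ineq-A : ∀ {a b c d} → ¬ Toward x g (leaf a) → ¬ Toward x g (leaf b) → Toward x g (leaf c) → Toward x g (leaf d) →
               ¬ SameBranch x (leaf a) (leaf b) → ¬ SameBranch q (leaf d) vr → Weighted.IneqA R P w leaf a b c d r
      ineq-A {a} {b} {c} {d} ¬fa ¬fb fc fd ¬ab ¬dr =
        single-split-A (leaf a) (leaf b) (leaf c) (leaf d) vr g (λ e → split-between-x-and-q ¬ab ¬dr)
          (λ e → ¬split-at x (¬toward-vs-toward ¬fa toward-r) (¬toward-vs-toward ¬fb fd)) g≢root
          (proj₁ sides) (proj₁ (proj₂ sides)) (toward-below≡ toward-r fc) (proj₂ (proj₂ sides)) w≢0
        where sides = sides-at-g ¬fa ¬fb fc fd

      condA : CondA P w leaf i j l m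
      condA = r , outside ,
        ineq-A ¬toward-i ¬toward-j toward-l toward-m ¬ij ¬mr-at-q ,
        ineq-A ¬toward-j ¬toward-i toward-l toward-m (¬sameBranch-sym ¬ij) ¬mr-at-q ,
        ineq-A ¬toward-i ¬toward-j toward-m toward-l ¬ij ¬lr-at-q ,
        ineq-A ¬toward-j ¬toward-i toward-m toward-l (¬sameBranch-sym ¬ij) ¬lr-at-q

    conditions-by : Dec (SameBranch q vl vm) → CondA P w leaf i j l m ⊎ CondB P w leaf i j l m
    conditions-by (yes lm-at-q) = inj₁ (ThirdLeaf.condA lm-at-q)
    conditions-by (no ¬lm-at-q) = inj₂ (condB ¬lm-at-q)

    conditions : CondA P w leaf i j l m ⊎ CondB P w leaf i j l m
    conditions = conditions-by (sameBranch? l≢q m≢q)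

  quartet⇒conditions : Essential P → InternalNonzero P w → Quartet P vi vj vl vm →
                       CondA P w leaf i j l m ⊎ CondB P w leaf i j l m
  quartet⇒conditions essential nonzero quartet with quartet⇒median quartet
  ... | x , x-med , lm = Forward.conditions essential nonzero x-med lm

proposition3p2 : (R : RealField) (n : ℕ) → 5 ≤ n →
    (N : ℕ) (P : Tree N) (w : Fin N → RealField.ℝ R) (leaf : Fin n → Fin N) →
    LeafSet P leaf → Essential P → Weighted.InternalNonzero R P w →
    (i j l m : Fin n) →
    i ≢ j → i ≢ l → i ≢ m → j ≢ l → j ≢ m → l ≢ m →
    Quartet P (leaf i) (leaf j) (leaf l) (leaf m) ⇔
      (Weighted.CondA R P w leaf i j l m ⊎ Weighted.CondB R P w leaf i j l m)
proposition3p2 R n 5≤n N P w leaf leaf-set essential nonzero i j l m i≢j i≢l i≢m j≢l j≢m l≢m =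
  mk⇔ (quartet⇒conditions essential nonzero) [ condA⇒quartet , condB⇒quartet (proj₂ (fifth-element 5≤n i j l m)) ]′
  where open Proposition R P w leaf leaf-set i j l m i≢j i≢l i≢m j≢l j≢m l≢m
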